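{- Let $G$ be an $R$-disjoint graph. Then every maximum matching $M$ of $G$ contains exactly $\lfloor |V(C)|/2\rfloor$ edges of $C$, for each odd cycle $C$ of $G$.
   Context: All graphs are finite, simple and undirected. Let $M$ be a matching of $G$. An $M$-blossom is an odd cycle of length $2k+1$ containing exactly $k$ edges of $M$; its base is the vertex of the cycle not covered by these $k$ edges. An $M$-stem is an $M$-alternating path of even length (possibly zero) joining the base of the blossom to a vertex not saturated by $M$, and sharing only the base with the blossom. An $M$-flower is an $M$-blossom together with an $M$-stem. For an odd cycle $C$ of $G$, the reach set $R(C)$ is the union of $V(F)$ over all $M$-flowers $F$ of $G$ whose $M$-blossom is $C$, where $M$ ranges over all maximum matchings of $G$. A graph $G$ is $R$-disjoint if it has at least one odd cycle, $R(C)\neq\emptyset$ for every odd cycle $C$, and $R(C)\cap R(C')=\emptyset$ for every two distinct odd cycles $C,C'$ of $G$. -}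

module Defs where

open import Data.Nat using (ℕ; _≤_; _*_; _+_; _%_; _<ᵇ_)
open import Data.Bool using (Bool; true; false)
open import Data.Fin using (Fin; toℕ; _≟_)
open import Data.Maybe using (Maybe; just; nothing)
open import Data.List using (List; []; _∷_; length; zip; _++_; [_]; filterᵇ; last; allFin)
open import Data.List.Relation.Unary.All using (All)
open import Data.List.Relation.Unary.Unique.Propositional using (Unique)
open import Data.List.Membership.Propositional using (_∈_)
open import Data.Product using (_×_; _,_; ∃; Σ; uncurry; proj₁; proj₂)
open import Data.Sum using (_⊎_)
open import Data.Empty using (⊥)
open import Data.Unit using (⊤)
open import Relation.Nullary using (¬_)
open import Relation.Nullary.Decidable using (⌊_⌋)
open import Relation.Binary.PropositionalEquality using (_≡_; _≢_)
open import Function.Bundles using (_⇔_)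

record Graph : Set₁ where
  field
    n     : ℕ
    E     : Fin n → Fin n → Set
    sym   : ∀ {u v} → E u v → E v u
    irrefl : ∀ {u} → ¬ E u u

module _ (G : Graph) where
  open Graph G

  V : Set
  V = Fin n

  -- A matching is given by its "mate" function: mate u ≡ just v iff uv ∈ M.
  Mate : Set
  Mate = V → Maybe V

  IsMatching : Mate → Set
  IsMatching M = ∀ u v → M u ≡ just v → E u v × M v ≡ just u

  inM : Mate → V → V → Bool
  inM M u v with M u
  ... | nothing = false
  ... | just w  = ⌊ w ≟ v ⌋

  -- |M| = number of edges uv of M (counted once, via u < v)
  lowEnd : V → Maybe V → Bool
  lowEnd u nothing  = false
  lowEnd u (just v) = toℕ u <ᵇ toℕ v

  size : Mate → ℕ
  size M = length (filterᵇ (λ u → lowEnd u (M u)) (allFin n))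

  IsMaximum : Mate → Set
  IsMaximum M = IsMatching M × (∀ M' → IsMatching M' → size M' ≤ size M)

  Unsaturated : Mate → V → Set
  Unsaturated M v = M v ≡ nothing

  cycEdges : List V → List (V × V)
  cycEdges []       = []
  cycEdges (x ∷ xs) = zip (x ∷ xs) (xs ++ [ x ])

  IsCycle : List V → Set
  IsCycle c = 3 ≤ length c × Unique c × All (uncurry E) (cycEdges c)

  IsOddCycle : List V → Set
  IsOddCycle c = IsCycle c × length c % 2 ≡ 1

  CEdge : List V → V → V → Set
  CEdge c u v = (u , v) ∈ cycEdges c ⊎ (v , u) ∈ cycEdges c

  -- Two vertex sequences describe the same cycle (same subgraph, i.e. same edge set).
  SameCycle : List V → List V → Set
  SameCycle c c' = ∀ u v → CEdge c u v ⇔ CEdge c' u v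

  countM : Mate → List V → ℕ
  countM M c = length (filterᵇ (λ e → inM M (proj₁ e) (proj₂ e)) (cycEdges c))

  IsBlossom : Mate → List V → Set
  IsBlossom M c = IsCycle c × length c ≡ 2 * countM M c + 1

  IsBase : Mate → List V → V → Set
  IsBase M c b = b ∈ c × (∀ u → CEdge c b u → inM M b u ≡ false × inM M u b ≡ false)

  Walk : List V → Set
  Walk (a ∷ b ∷ r) = E a b × Walk (b ∷ r)
  Walk _           = ⊤

  Alternating : Mate → List V → Set
  Alternating M (a ∷ b ∷ c ∷ r) = inM M a b ≢ inM M b c × Alternating M (b ∷ c ∷ r)
  Alternating M _               = ⊤

  IsStem : Mate → List V → V → List V → Set
  IsStem M c b rest =
    Unique (b ∷ rest) × Walk (b ∷ rest) × Alternating M (b ∷ rest)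
    × length rest % 2 ≡ 0
    × (∃ λ w → last (b ∷ rest) ≡ just w × Unsaturated M w)
    × (∀ x → x ∈ (b ∷ rest) → x ∈ c → x ≡ b)

  IsFlower : Mate → List V → V → List V → Set
  IsFlower M c b rest = IsBlossom M c × IsBase M c b × IsStem M c b rest

  R : List V → V → Set
  R C x = ∃ λ M → ∃ λ c → ∃ λ b → ∃ λ rest →
            IsMaximum M × SameCycle c C × IsFlower M c b rest
            × (x ∈ c ⊎ x ∈ (b ∷ rest))

  RDisjoint : Set
  RDisjoint =
    (∃ λ c → IsOddCycle c)
    × (∀ c → IsOddCycle c → ∃ λ x → R c x)
    × (∀ c c' → IsOddCycle c → IsOddCycle c' → ¬ SameCycle c c' →
         ∀ x → R c x → R c' x → ⊥)

-- Let c be an odd cycle of length 2k + 1 and M a maximum matching; M has at most k edges on c.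
-- R-disjointness is used twice. First, c is isolated: a chord of c, or a path between two vertices
-- of c through vertices outside c, closes a second odd cycle through a vertex of c, and every vertex
-- of c lies in R(c). Second, a flower on c for some maximum matching M₀ yields, after dropping the
-- blossom and shifting the stem, a matching N that avoids c and has at least |M₀| - k edges.
-- Now let x₀ on c be matched by M to u outside c. Trading M for N on everything reachable from u by
-- M- and N-edges outside c (by isolation this part touches c only at x₀) leaves a maximum matching
-- with the same edges on c and fewer such vertices x₀. Once no vertex of c is matched outside c,
-- isolation makes every M-edge at c an edge of c, and replacing them by a near-perfect matching of
-- c would enlarge M unless M already had k edges on c.

module Submission where

open import Defs
open import Data.Nat using (ℕ; _+_; _≤_; ⌊_/2⌋)
open import Data.Nat.Properties using (≤-antisym; ≤-refl; ⌊n/2⌋-mono)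
open import Data.Bool using (Bool; true)
open import Data.Fin using (Fin)
open import Data.List using (List; length)
open import Data.List.Membership.Propositional using (_∈_)
open import Data.Maybe using (nothing)
open import Data.Product using (_,_; proj₁)
open import Relation.Binary.PropositionalEquality using (_≡_; subst)

module ListFacts where

  open import Data.List using (List; []; _∷_; _++_)
  open import Data.List.Membership.Propositional using (_∈_)
  open import Data.List.Membership.Propositional.Properties using (∈-++⁺ˡ; ∈-++⁺ʳ)
  open import Data.List.Relation.Unary.Any using (here; there)
  open import Data.List.Relation.Unary.Unique.Propositional using (Unique)
  open import Data.List.Relation.Unary.AllPairs using ([]; _∷_)
  open import Data.List.Relation.Unary.All.Properties using (All¬⇒¬Any; ¬Any⇒All¬)
  open import Data.List.Relation.Binary.Permutation.Propositional using (_↭_; ↭⇒↭ₛ)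
  import Data.List.Relation.Binary.Permutation.Setoid.Properties as SetoidPermutation
  open import Relation.Binary.PropositionalEquality.Properties using (setoid)
  open import Data.Product using (_×_; _,_)
  open import Data.Empty using (⊥)
  open import Relation.Binary.PropositionalEquality hiding ([_])

  Unique-resp-↭ : ∀ {A : Set} {xs ys : List A} → xs ↭ ys → Unique xs → Unique ys
  Unique-resp-↭ {A} p = SetoidPermutation.Unique-resp-↭ (setoid A) (↭⇒↭ₛ p)

  Unique-++⁻ : ∀ {A : Set} (xs : List A) {ys} → Unique (xs ++ ys) →
               Unique xs × Unique ys × (∀ {v} → v ∈ xs → v ∈ ys → ⊥)
  Unique-++⁻ []       u          = [] , u , λ ()
  Unique-++⁻ (x ∷ xs) (x∉ ∷ u) with Unique-++⁻ xs u
  ... | uxs , uys , disjoint =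
    (¬Any⇒All¬ xs (λ x∈xs → All¬⇒¬Any x∉ (∈-++⁺ˡ x∈xs)) ∷ uxs) , uys ,
    λ { (here refl) v∈ys → All¬⇒¬Any x∉ (∈-++⁺ʳ xs v∈ys) ; (there v∈xs) → disjoint v∈xs }

module Counting where

  open import Data.Nat using (ℕ; zero; suc; _+_; _≤_; _<_; z≤n; s≤s)
  open import Data.Nat.Properties
    using (+-0-commutativeMonoid; +-mono-≤; +-mono-<-≤; +-mono-≤-<; <-irrefl; ≤-<-trans)
  open import Data.Bool using (Bool; true; false; _∨_; _∧_; not)
  open import Data.Bool.Properties using (∧-identityʳ; ∧-zeroʳ; ∨-identityʳ; ∨-zeroʳ)
  open import Data.Fin using (Fin; zero; suc; _≟_)
  open import Data.List using (List; []; _∷_; length; filterᵇ; tabulate; allFin)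
  open import Data.List.Relation.Unary.Unique.Propositional using (Unique)
  open import Data.List.Relation.Unary.AllPairs using ([]; _∷_)
  open import Data.List.Relation.Binary.Permutation.Propositional using (_↭_; ↭-sym)
  open import Data.List.Relation.Binary.Permutation.Propositional.Properties using (∈-resp-↭)
  open import Data.Product using (∃; _,_)
  open import Data.Empty using (⊥)
  open import Function using (_∘_; id)
  open import Relation.Nullary using (Dec; yes; no; does; contradiction)
  open import Relation.Nullary.Decidable using (dec-true; dec-false)
  open import Relation.Binary.Definitions using (DecidableEquality)
  open import Data.List.Membership.Propositional using (_∈_; _∉_)
  open import Data.List.Relation.Unary.Any using (here; there)
  open import Data.List.Relation.Unary.All.Properties using (All¬⇒¬Any)
  open import Relation.Binary.PropositionalEquality
    using (_≡_; refl; sym; trans; cong; cong₂; module ≡-Reasoning)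
  open import Algebra.Properties.CommutativeMonoid.Sum +-0-commutativeMonoid
    using (sum; ∑-distrib-+; sum-cong-≗)
  import Data.List.Membership.DecPropositional as DecMembership

  from-does : ∀ {A : Set} (a? : Dec A) → does a? ≡ true → A
  from-does (yes a) _ = a

  bit : Bool → ℕ
  bit false = 0
  bit true  = 1

  count : ∀ {n} → (Fin n → Bool) → ℕ
  count p = sum (bit ∘ p)

  _⊆_ : ∀ {n} → (Fin n → Bool) → (Fin n → Bool) → Set
  p ⊆ q = ∀ i → p i ≡ true → q i ≡ true

  sum-mono-≤ : ∀ {n} {f g : Fin n → ℕ} → (∀ i → f i ≤ g i) → sum f ≤ sum g
  sum-mono-≤ {zero}  f≤g = z≤n
  sum-mono-≤ {suc n} f≤g = +-mono-≤ (f≤g zero) (sum-mono-≤ (f≤g ∘ suc))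

  sum-mono-< : ∀ {n} {f g : Fin n → ℕ} → (∀ i → f i ≤ g i) → ∀ i → f i < g i → sum f < sum g
  sum-mono-< f≤g zero    fi<gi = +-mono-<-≤ fi<gi (sum-mono-≤ (f≤g ∘ suc))
  sum-mono-< f≤g (suc i) fi<gi = +-mono-≤-< (f≤g zero) (sum-mono-< (f≤g ∘ suc) i fi<gi)

  bit-mono : ∀ {a b} → (a ≡ true → b ≡ true) → bit a ≤ bit b
  bit-mono {false} a⇒b = z≤n
  bit-mono {true}  a⇒b with refl ← a⇒b refl = s≤s z≤n

  module _ {n : ℕ} where

    count-cong : {p q : Fin n → Bool} → (∀ i → p i ≡ q i) → count p ≡ count q
    count-cong p≗q = sum-cong-≗ (cong bit ∘ p≗q)

    count-mono : {p q : Fin n → Bool} → p ⊆ q → count p ≤ count q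
    count-mono p⊆q = sum-mono-≤ (λ i → bit-mono (p⊆q i))

    count-mono-< : {p q : Fin n → Bool} → p ⊆ q → ∀ i → p i ≡ false → q i ≡ true → count p < count q
    count-mono-< p⊆q i pi qi = sum-mono-< (λ j → bit-mono (p⊆q j)) i (bit-< pi qi)
      where
      bit-< : ∀ {a b} → a ≡ false → b ≡ true → bit a < bit b
      bit-< refl refl = s≤s z≤n

    ⊆-count-≥⇒⊇ : {p q : Fin n → Bool} → p ⊆ q → count q ≤ count p → q ⊆ p
    ⊆-count-≥⇒⊇ {p} p⊆q q≤p i qi with p i in pi
    ... | true  = refl
    ... | false = contradiction (≤-<-trans q≤p (count-mono-< p⊆q i pi qi)) (<-irrefl refl)

    count-∨ : {p q : Fin n → Bool} → (∀ i → p i ≡ true → q i ≡ true → ⊥) →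
              count (λ i → p i ∨ q i) ≡ count p + count q
    count-∨ {p} {q} disjoint =
      trans (sum-cong-≗ (λ i → bit-∨ (p i) (q i) (disjoint i))) (∑-distrib-+ (bit ∘ p) (bit ∘ q))
      where
      bit-∨ : ∀ a b → (a ≡ true → b ≡ true → ⊥) → bit (a ∨ b) ≡ bit a + bit b
      bit-∨ true  true  d = contradiction refl (d refl)
      bit-∨ true  false d = refl
      bit-∨ false b     d = refl

  count≤n : ∀ {n} (p : Fin n → Bool) → count p ≤ n
  count≤n {zero}  p = z≤n
  count≤n {suc n} p = +-mono-≤ (bit≤1 (p zero)) (count≤n (p ∘ suc))
    where
    bit≤1 : ∀ b → bit b ≤ 1
    bit≤1 false = z≤n
    bit≤1 true  = s≤s z≤n

  count≡0 : ∀ {n} (p : Fin n → Bool) → count p ≡ 0 → ∀ i → p i ≡ false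
  count≡0 p #p≡0 zero with p zero
  ... | false = refl
  count≡0 p #p≡0 (suc i) with p zero
  ... | false = count≡0 (p ∘ suc) #p≡0 i

  count>0 : ∀ {n} (p : Fin n → Bool) → 0 < count p → ∃ λ i → p i ≡ true
  count>0 {suc n} p #p>0 with p zero in p0
  ... | true  = zero , p0
  ... | false with count>0 (p ∘ suc) #p>0
  ... | i , pi = suc i , pi

  count-partition : ∀ {n} (q p : Fin n → Bool) → count p ≡ count (λ i → q i ∧ p i) + count (λ i → not (q i) ∧ p i)
  count-partition q p = trans (count-cong split) (count-∨ disjoint)
    where
    split : ∀ i → p i ≡ (q i ∧ p i) ∨ (not (q i) ∧ p i)
    split i with q i
    ... | true  = sym (∨-identityʳ (p i))
    ... | false = refl
    disjoint : ∀ i → q i ∧ p i ≡ true → not (q i) ∧ p i ≡ true → ⊥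
    disjoint i qp nqp with q i
    disjoint i () nqp | false

  length-filter-tabulate : ∀ {n} {A : Set} (r : A → Bool) (f : Fin n → A) →
                           length (filterᵇ r (tabulate f)) ≡ count (r ∘ f)
  length-filter-tabulate {zero}  r f = refl
  length-filter-tabulate {suc n} r f with r (f zero)
  ... | true  = cong suc (length-filter-tabulate r (f ∘ suc))
  ... | false = length-filter-tabulate r (f ∘ suc)

  length-filter-allFin : ∀ {n} (r : Fin n → Bool) → length (filterᵇ r (allFin n)) ≡ count r
  length-filter-allFin r = length-filter-tabulate r id

  count-∅ : ∀ n → count {n} (λ _ → false) ≡ 0
  count-∅ zero    = refl
  count-∅ (suc n) = count-∅ n

  count-≟ : ∀ {n} (i : Fin n) → count (λ j → does (j ≟ i)) ≡ 1
  count-≟ {suc n} zero    = cong suc (count-∅ n)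
  count-≟ {suc n} (suc i) = count-≟ i

  _∈?_ : ∀ {n} (x : Fin n) xs → Dec (x ∈ xs)
  x ∈? xs = DecMembership._∈?_ _≟_ x xs

  _∈ᵇ_ : ∀ {n} → Fin n → List (Fin n) → Bool
  x ∈ᵇ xs = does (x ∈? xs)

  module _ {n : ℕ} {x : Fin n} (xs : List (Fin n)) where

    ∈ᵇ⇒∈ : x ∈ᵇ xs ≡ true → x ∈ xs
    ∈ᵇ⇒∈ = from-does (x ∈? xs)

    ∈⇒∈ᵇ : x ∈ xs → x ∈ᵇ xs ≡ true
    ∈⇒∈ᵇ = dec-true (x ∈? xs)

    ∉⇒∈ᵇ : x ∉ xs → x ∈ᵇ xs ≡ false
    ∉⇒∈ᵇ = dec-false (x ∈? xs)

    ∈ᵇ-false⇒∉ : x ∈ᵇ xs ≡ false → x ∉ xs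
    ∈ᵇ-false⇒∉ eq x∈ = contradiction (trans (sym eq) (∈⇒∈ᵇ x∈)) λ ()

  ∈ᵇ-cong : ∀ {n} {x : Fin n} {xs ys} → (x ∈ xs → x ∈ ys) → (x ∈ ys → x ∈ xs) → x ∈ᵇ xs ≡ x ∈ᵇ ys
  ∈ᵇ-cong {x = x} {xs} {ys} to from with x ∈? xs | x ∈? ys
  ... | yes _   | yes _   = refl
  ... | no  _   | no  _   = refl
  ... | yes x∈  | no  x∉ = contradiction (to x∈) x∉
  ... | no  x∉  | yes x∈ = contradiction (from x∈) x∉

  ∈ᵇ-resp-↭ : ∀ {n} {xs ys : List (Fin n)} → xs ↭ ys → ∀ x → x ∈ᵇ xs ≡ x ∈ᵇ ys
  ∈ᵇ-resp-↭ xs↭ys x = ∈ᵇ-cong (∈-resp-↭ xs↭ys) (∈-resp-↭ (↭-sym xs↭ys))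

  count-∈ᵇ : ∀ {n} {xs : List (Fin n)} → Unique xs → count (_∈ᵇ xs) ≡ length xs
  count-∈ᵇ {n} {[]}     []        = count-∅ n
  count-∈ᵇ {xs = x ∷ xs} (x∉ ∷ u) = trans (count-∨ disjoint) (cong₂ _+_ (count-≟ x) (count-∈ᵇ u))
    where
    disjoint : ∀ j → does (j ≟ x) ≡ true → j ∈ᵇ xs ≡ true → ⊥
    disjoint j j≡x j∈xs with refl ← from-does (j ≟ x) j≡x = All¬⇒¬Any x∉ (∈ᵇ⇒∈ xs j∈xs)

  count-without : ∀ {n} (p : Fin n → Bool) {i} → p i ≡ true → count (λ j → p j ∧ not (does (j ≟ i))) + 1 ≡ count p
  count-without p {i} pi = begin
    count p-i + 1                                ≡⟨ cong (count p-i +_) (count-≟ i) ⟨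
    count p-i + count (λ j → does (j ≟ i))       ≡⟨ count-∨ disjoint ⟨
    count (λ j → p-i j ∨ does (j ≟ i))           ≡⟨ count-cong split ⟩
    count p                                      ∎
    where
    open ≡-Reasoning
    p-i : _ → Bool
    p-i j = p j ∧ not (does (j ≟ i))
    disjoint : ∀ j → p j ∧ not (does (j ≟ i)) ≡ true → does (j ≟ i) ≡ true → ⊥
    disjoint j pj j≡i rewrite j≡i = contradiction (trans (sym (∧-zeroʳ (p j))) pj) λ ()
    split : ∀ j → (p j ∧ not (does (j ≟ i))) ∨ does (j ≟ i) ≡ p j
    split j with j ≟ i
    ... | yes refl = trans (∨-zeroʳ _) (sym pi)
    ... | no  _    = trans (∨-identityʳ _) (∧-identityʳ (p j))

  countᴸ : ∀ {A : Set} → (A → Bool) → List A → ℕ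
  countᴸ p L = length (filterᵇ p L)

  module _ {A : Set} where

    countᴸ-∷ : ∀ (p : A → Bool) x L → countᴸ p (x ∷ L) ≡ bit (p x) + countᴸ p L
    countᴸ-∷ p x L with p x
    ... | true  = refl
    ... | false = refl

    countᴸ-false : ∀ (L : List A) → countᴸ (λ _ → false) L ≡ 0
    countᴸ-false []      = refl
    countᴸ-false (_ ∷ L) = countᴸ-false L

    countᴸ-cong : ∀ {p q : A → Bool} L → (∀ x → x ∈ L → p x ≡ q x) → countᴸ p L ≡ countᴸ q L
    countᴸ-cong                 []      p≗q = refl
    countᴸ-cong {p = p} {q = q} (x ∷ L) p≗q = begin
      countᴸ p (x ∷ L)        ≡⟨ countᴸ-∷ p x L ⟩
      bit (p x) + countᴸ p L  ≡⟨ cong₂ (λ b m → bit b + m) (p≗q x (here refl))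
                                       (countᴸ-cong L (λ y y∈ → p≗q y (there y∈))) ⟩
      bit (q x) + countᴸ q L  ≡⟨ countᴸ-∷ q x L ⟨
      countᴸ q (x ∷ L)        ∎
      where open ≡-Reasoning

    countᴸ-by-fibres : ∀ {n} (f : A → Fin n) (p : A → Bool) L →
                       countᴸ p L ≡ sum (λ i → countᴸ (λ x → does (i ≟ f x) ∧ p x) L)
    countᴸ-by-fibres {n} f p []      = sym (count-∅ n)
    countᴸ-by-fibres {n} f p (x ∷ L) = begin
      countᴸ p (x ∷ L)
        ≡⟨ countᴸ-∷ p x L ⟩
      bit (p x) + countᴸ p L
        ≡⟨ cong₂ _+_ (sym (fibre-of x)) (countᴸ-by-fibres f p L) ⟩
      sum (λ i → bit (fibre i x)) + sum (λ i → countᴸ (fibre i) L)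
        ≡⟨ ∑-distrib-+ (λ i → bit (fibre i x)) (λ i → countᴸ (fibre i) L) ⟨
      sum (λ i → bit (fibre i x) + countᴸ (fibre i) L)
        ≡⟨ sum-cong-≗ (λ i → sym (countᴸ-∷ (fibre i) x L)) ⟩
      sum (λ i → countᴸ (fibre i) (x ∷ L)) ∎
      where
      open ≡-Reasoning
      fibre : Fin _ → A → Bool
      fibre i y = does (i ≟ f y) ∧ p y
      fibre-of : ∀ y → sum (λ i → bit (fibre i y)) ≡ bit (p y)
      fibre-of y with p y
      ... | true  = trans (count-cong (λ i → ∧-identityʳ (does (i ≟ f y)))) (count-≟ (f y))
      ... | false = trans (count-cong (λ i → ∧-zeroʳ (does (i ≟ f y)))) (count-∅ n)

  module _ {A : Set} (_≟ᴬ_ : DecidableEquality A) where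
    open DecMembership _≟ᴬ_ using () renaming (_∈?_ to _∈ᴬ?_)

    countᴸ-≟ : ∀ {L} → Unique L → ∀ a → countᴸ (λ x → does (a ≟ᴬ x)) L ≡ bit (does (a ∈ᴬ? L))
    countᴸ-≟ {[]}    []       a = refl
    countᴸ-≟ {x ∷ L} (x∉ ∷ u) a with a ≟ᴬ x
    ... | yes refl = cong suc (countᴸ-absent L (All¬⇒¬Any x∉))
      where
      countᴸ-absent : ∀ L → a ∉ L → countᴸ (λ x → does (a ≟ᴬ x)) L ≡ 0
      countᴸ-absent []      a∉ = refl
      countᴸ-absent (y ∷ L) a∉ with a ≟ᴬ y
      ... | yes a≡y = contradiction (here a≡y) a∉
      ... | no  _   = countᴸ-absent L (a∉ ∘ there)
    ... | no  _    = countᴸ-≟ u a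

module Parity where

  open import Data.Nat using (zero; suc; _+_; _*_; _%_; ⌊_/2⌋)
  open import Data.Nat.Properties using (*-suc; +-suc)
  open import Data.Nat.DivMod using (%-distribˡ-+)
  open import Data.Sum using (_⊎_; inj₁; inj₂)
  open import Relation.Nullary using (contradiction)
  open import Relation.Binary.PropositionalEquality

  parity : ∀ m → m % 2 ≡ 0 ⊎ m % 2 ≡ 1
  parity zero          = inj₁ refl
  parity (suc zero)    = inj₂ refl
  parity (suc (suc m)) = parity m

  private
    residue-+ : ∀ m n {a b} → m % 2 ≡ a → n % 2 ≡ b → (m + n) % 2 ≡ (a + b) % 2
    residue-+ m n refl refl = %-distribˡ-+ m n 2

  odd-split : ∀ y z q → (y + z) % 2 ≡ 1 → (q + z) % 2 ≡ 1 ⊎ (q + y) % 2 ≡ 1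
  odd-split y z q yz with parity y | parity z | parity q
  ... | inj₁ y0 | inj₁ z0 | _       = contradiction (trans (sym (residue-+ y z y0 z0)) yz) λ ()
  ... | inj₂ y1 | inj₂ z1 | _       = contradiction (trans (sym (residue-+ y z y1 z1)) yz) λ ()
  ... | inj₁ y0 | inj₂ z1 | inj₁ q0 = inj₁ (residue-+ q z q0 z1)
  ... | inj₁ y0 | inj₂ z1 | inj₂ q1 = inj₂ (residue-+ q y q1 y0)
  ... | inj₂ y1 | inj₁ z0 | inj₁ q0 = inj₂ (residue-+ q y q0 y1)
  ... | inj₂ y1 | inj₁ z0 | inj₂ q1 = inj₁ (residue-+ q z q1 z0)

  odd⇒≡2*⌊/2⌋+1 : ∀ m → m % 2 ≡ 1 → m ≡ 2 * ⌊ m /2⌋ + 1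
  odd⇒≡2*⌊/2⌋+1 (suc zero)    _   = refl
  odd⇒≡2*⌊/2⌋+1 (suc (suc m)) odd =
    trans (cong (λ k → suc (suc k)) (odd⇒≡2*⌊/2⌋+1 m odd)) (cong (_+ 1) (sym (*-suc 2 ⌊ m /2⌋)))

  even-suc⇒odd : ∀ m → suc m % 2 ≡ 0 → m % 2 ≡ 1
  even-suc⇒odd (suc zero)    _    = refl
  even-suc⇒odd (suc (suc m)) even = even-suc⇒odd m even

  odd-suc⇒even : ∀ m → suc m % 2 ≡ 1 → m % 2 ≡ 0
  odd-suc⇒even zero          _   = refl
  odd-suc⇒even (suc (suc m)) odd = odd-suc⇒even m odd

  ⌊2*n/2⌋≡n : ∀ n → ⌊ 2 * n /2⌋ ≡ n
  ⌊2*n/2⌋≡n zero    = refl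
  ⌊2*n/2⌋≡n (suc n) = trans (cong (λ m → ⌊ suc m /2⌋) (+-suc n (n + 0))) (cong suc (⌊2*n/2⌋≡n n))

module CycleLists (G : Graph) where

  open import Data.Nat using (suc; pred; _≤_; s≤s)
  open import Data.Fin using (Fin; _≟_)
  open import Data.List using (List; []; _∷_; _++_; [_]; zip; map; length)
  open import Data.List.Properties using (++-assoc; ++-identityʳ; length-++-comm)
  open import Data.List.Membership.Propositional using (_∈_)
  open import Data.List.Membership.Propositional.Properties using (∈-map⁺; ∈-map⁻; ∈-∃++)
  open import Data.List.Relation.Unary.Any using (here; there)
  open import Data.List.Relation.Unary.Unique.Propositional using (Unique)
  open import Data.List.Relation.Unary.Unique.Propositional.Properties using (Unique[x∷xs]⇒x∉xs)
  open import Data.List.Relation.Unary.AllPairs using ([]; _∷_)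
  open import Data.List.Relation.Binary.Permutation.Propositional
    using (_↭_; ↭-refl; ↭-trans; ↭-sym)
  import Data.List.Relation.Binary.Permutation.Setoid.Properties as SetoidPermutation
  open import Data.List.Relation.Binary.Permutation.Propositional.Properties
    using (∷↭∷ʳ; ∈-resp-↭; ++-comm; ↭-length; All-resp-↭)
  open import Data.Product using (_×_; _,_; proj₁; proj₂; ∃; uncurry)
  import Data.Sum as Sum
  open import Data.Sum using (inj₁; inj₂)
  open import Relation.Nullary using (Dec)
  open import Relation.Nullary.Decidable using (_⊎-dec_; _×-dec_; map′)
  open import Relation.Binary.Definitions using (DecidableEquality)
  import Data.List.Membership.DecPropositional as DecMembership
  open import Function.Bundles using (Equivalence)
  import Function.Properties.Equivalence
  open import Data.Empty using (⊥)
  open import Relation.Binary.PropositionalEquality hiding ([_])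
  open import Relation.Nullary using (contradiction)
  open ListFacts

  open Graph G using (n)

  private
    zip-∷ʳ : ∀ {A B : Set} (xs : List A) (ys : List B) {a b} → length xs ≡ length ys →
             zip (xs ++ [ a ]) (ys ++ [ b ]) ≡ zip xs ys ++ [ (a , b) ]
    zip-∷ʳ []       []       eq = refl
    zip-∷ʳ (x ∷ xs) (y ∷ ys) eq = cong ((x , y) ∷_) (zip-∷ʳ xs ys (cong pred eq))

    cycEdges-rotate₁ : ∀ x xs → cycEdges G (x ∷ xs) ↭ cycEdges G (xs ++ [ x ])
    cycEdges-rotate₁ x []       = ↭-refl
    cycEdges-rotate₁ x (y ∷ ys) =
      subst ((x , y) ∷ zip (y ∷ ys) (ys ++ [ x ]) ↭_)
            (sym (zip-∷ʳ (y ∷ ys) (ys ++ [ x ]) (length-++-comm [ x ] ys)))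
            (∷↭∷ʳ (x , y) (zip (y ∷ ys) (ys ++ [ x ])))

  cycEdges-rotate : ∀ p q → cycEdges G (p ++ q) ↭ cycEdges G (q ++ p)
  cycEdges-rotate []      q = subst (λ r → cycEdges G q ↭ cycEdges G r) (sym (++-identityʳ q)) ↭-refl
  cycEdges-rotate (x ∷ p) q = ↭-trans (cycEdges-rotate₁ x (p ++ q))
    (subst (λ r → cycEdges G r ↭ cycEdges G (q ++ x ∷ p)) (sym (++-assoc p q [ x ]))
      (subst (λ r → cycEdges G (p ++ q ++ [ x ]) ↭ cycEdges G r) (++-assoc q [ x ] p)
        (cycEdges-rotate p (q ++ [ x ]))))

  private
    map-proj₁-zip : ∀ {A B : Set} (xs : List A) (ys : List B) → length xs ≡ length ys → map proj₁ (zip xs ys) ≡ xs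
    map-proj₁-zip []       []       eq = refl
    map-proj₁-zip (x ∷ xs) (y ∷ ys) eq = cong (x ∷_) (map-proj₁-zip xs ys (cong pred eq))

    map-proj₂-zip : ∀ {A B : Set} (xs : List A) (ys : List B) → length xs ≡ length ys → map proj₂ (zip xs ys) ≡ ys
    map-proj₂-zip []       []       eq = refl
    map-proj₂-zip (x ∷ xs) (y ∷ ys) eq = cong (y ∷_) (map-proj₂-zip xs ys (cong pred eq))

  map-proj₁-cycEdges : ∀ l → map proj₁ (cycEdges G l) ≡ l
  map-proj₁-cycEdges []       = refl
  map-proj₁-cycEdges (x ∷ xs) = map-proj₁-zip (x ∷ xs) (xs ++ [ x ]) (length-++-comm [ x ] xs)

  map-proj₂-cycEdges : ∀ x xs → map proj₂ (cycEdges G (x ∷ xs)) ≡ xs ++ [ x ]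
  map-proj₂-cycEdges x xs = map-proj₂-zip (x ∷ xs) (xs ++ [ x ]) (length-++-comm [ x ] xs)

  cycEdges-∈ˡ : ∀ {l a b} → (a , b) ∈ cycEdges G l → a ∈ l
  cycEdges-∈ˡ {l} e = subst (_ ∈_) (map-proj₁-cycEdges l) (∈-map⁺ proj₁ e)

  cycEdges-∈ʳ : ∀ {l a b} → (a , b) ∈ cycEdges G l → b ∈ l
  cycEdges-∈ʳ {x ∷ xs} e =
    ∈-resp-↭ (↭-sym (∷↭∷ʳ x xs)) (subst (_ ∈_) (map-proj₂-cycEdges x xs) (∈-map⁺ proj₂ e))

  cycEdges-from : ∀ {l a} → a ∈ l → ∃ λ b → (a , b) ∈ cycEdges G l
  cycEdges-from {l} a∈l with ∈-map⁻ proj₁ (subst (_ ∈_) (sym (map-proj₁-cycEdges l)) a∈l)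
  ... | (a , b) , e , refl = b , e

  private
    unique-map-injective : ∀ {A B : Set} (f : A → B) {L : List A} {x y} →
                           Unique (map f L) → x ∈ L → y ∈ L → f x ≡ f y → x ≡ y
    unique-map-injective f u       (here refl) (here refl) eq = refl
    unique-map-injective f {_ ∷ L} u (here refl) (there y∈) eq =
      contradiction (subst (_∈ map f L) (sym eq) (∈-map⁺ f y∈)) (Unique[x∷xs]⇒x∉xs u)
    unique-map-injective f {_ ∷ L} u (there x∈) (here refl) eq =
      contradiction (subst (_∈ map f L) eq (∈-map⁺ f x∈)) (Unique[x∷xs]⇒x∉xs u)
    unique-map-injective f (_ ∷ u) (there x∈)  (there y∈)  eq = unique-map-injective f u x∈ y∈ eq

  cycEdges-functional : ∀ {l a b b′} → Unique l →
                        (a , b) ∈ cycEdges G l → (a , b′) ∈ cycEdges G l → b ≡ b′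
  cycEdges-functional {l} u e e′ =
    cong proj₂ (unique-map-injective proj₁ (subst Unique (sym (map-proj₁-cycEdges l)) u) e e′ refl)

  record Rotation (l r : List (Fin n)) : Set where
    field
      vertices : l ↭ r
      edges    : cycEdges G l ↭ cycEdges G r

  rotation : ∀ p q → Rotation (p ++ q) (q ++ p)
  rotation p q = record { vertices = ++-comm p q ; edges = cycEdges-rotate p q }

  rotate-to : ∀ {l x} → x ∈ l → ∃ λ s → Rotation l (x ∷ s)
  rotate-to x∈l with ∈-∃++ x∈l
  ... | p , s , refl = s ++ p , rotation p (_ ∷ s)

  IsCycle-rotate : ∀ {l r} → Rotation l r → IsCycle G l → IsCycle G r
  IsCycle-rotate ρ (3≤l , u , walk) =
    subst (3 ≤_) (↭-length vertices) 3≤l , Unique-resp-↭ vertices u , All-resp-↭ edges walk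
    where open Rotation ρ

  cycEdges-asym : ∀ {l a b} → Unique l → 3 ≤ length l →
                  (a , b) ∈ cycEdges G l → (b , a) ∈ cycEdges G l → ⊥
  cycEdges-asym u 3≤l ab ba with rotate-to (cycEdges-∈ˡ ab)
  ... | s , ρ = go s (Unique-resp-↭ vertices u) (subst (3 ≤_) (↭-length vertices) 3≤l)
                  (∈-resp-↭ edges ab) (∈-resp-↭ edges ba)
    where
    open Rotation ρ
    go : ∀ {a b} s → Unique (a ∷ s) → 3 ≤ suc (length s) →
         (a , b) ∈ cycEdges G (a ∷ s) → (b , a) ∈ cycEdges G (a ∷ s) → ⊥
    go []            u (s≤s ()) ab ba
    go (y₀ ∷ [])     u (s≤s (s≤s ())) ab ba
    go (y₀ ∷ y₁ ∷ ys) u _ ab ba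
      with refl ← cycEdges-functional u ab (here refl)
      with refl ← cycEdges-functional u ba (there (here refl))
      = Unique[x∷xs]⇒x∉xs u (there (here refl))

  CEdge-sym : ∀ {c x y} → CEdge G c x y → CEdge G c y x
  CEdge-sym = Sum.swap

  CEdge-∈ : ∀ {c x y} → CEdge G c x y → x ∈ c
  CEdge-∈ (inj₁ xy) = cycEdges-∈ˡ xy
  CEdge-∈ (inj₂ yx) = cycEdges-∈ʳ yx

  SameCycle-∈ : ∀ {c c′ x} → SameCycle G c c′ → x ∈ c′ → x ∈ c
  SameCycle-∈ same x∈c′ with cycEdges-from x∈c′
  ... | y , xy = CEdge-∈ (Equivalence.from (same _ y) (inj₁ xy))

  _≟²_ : ∀ {n} → DecidableEquality (Fin n × Fin n)
  (a , b) ≟² (c , d) = map′ (uncurry (cong₂ _,_)) (λ eq → cong proj₁ eq , cong proj₂ eq) ((a ≟ c) ×-dec (b ≟ d))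

  _∈²?_ : ∀ {n} (e : Fin n × Fin n) L → Dec (e ∈ L)
  e ∈²? L = DecMembership._∈?_ _≟²_ e L

  CEdge? : ∀ c x y → Dec (CEdge G c x y)
  CEdge? c x y = ((x , y) ∈²? cycEdges G c) ⊎-dec ((y , x) ∈²? cycEdges G c)

  SameCycle-sym : ∀ {c c′} → SameCycle G c c′ → SameCycle G c′ c
  SameCycle-sym same u v = Function.Properties.Equivalence.sym (same u v)

module Paths (G : Graph) where

  open Counting using (_∈?_)
  open ListFacts using (Unique-++⁻)
  open import Data.List using (List; []; _∷_; _++_; [_]; _∷ʳ_; reverse; last; zip)
  open import Data.List.Properties using (++-assoc; unfold-reverse)
  open import Data.List.Membership.Propositional using (_∈_)
  open import Data.List.Membership.Propositional.Properties using (∈-∃++; ∈-++⁺ʳ)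
  open import Data.List.Relation.Unary.Any using (here; there)
  open import Data.List.Relation.Unary.All using (All; _∷_)
  import Data.List.Relation.Unary.All as All
  open import Data.List.Relation.Unary.AllPairs using ([]; _∷_)
  open import Data.List.Relation.Unary.All.Properties using (¬Any⇒All¬)
  open import Data.List.Relation.Unary.Unique.Propositional using (Unique)
  open import Data.Maybe using (just)
  open import Data.Product using (_×_; _,_; proj₁; proj₂; ∃; uncurry)
  open import Data.Unit using (tt)
  open import Relation.Nullary using (yes; no)
  open import Relation.Binary.PropositionalEquality hiding ([_])

  open Graph G using (n; E) renaming (sym to E-sym)

  walk-tail : ∀ {x} l → Walk G (x ∷ l) → Walk G l
  walk-tail []      w = tt
  walk-tail (_ ∷ _) w = proj₂ w

  walk-++ : ∀ l₁ {m l₂} → Walk G (l₁ ++ [ m ]) → Walk G (m ∷ l₂) → Walk G (l₁ ++ m ∷ l₂)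
  walk-++ []           w₁ w₂ = w₂
  walk-++ (x ∷ [])     w₁ w₂ = proj₁ w₁ , w₂
  walk-++ (x ∷ y ∷ l₁) w₁ w₂ = proj₁ w₁ , walk-++ (y ∷ l₁) (proj₂ w₁) w₂

  walk-++⁻ˡ : ∀ l₁ {l₂} → Walk G (l₁ ++ l₂) → Walk G l₁
  walk-++⁻ˡ []           w = tt
  walk-++⁻ˡ (x ∷ [])     w = tt
  walk-++⁻ˡ (x ∷ y ∷ l₁) w = proj₁ w , walk-++⁻ˡ (y ∷ l₁) (proj₂ w)

  walk-++⁻ʳ : ∀ l₁ {l₂} → Walk G (l₁ ++ l₂) → Walk G l₂
  walk-++⁻ʳ []       w = w
  walk-++⁻ʳ (x ∷ l₁) w = walk-++⁻ʳ l₁ (walk-tail (l₁ ++ _) w)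

  walk-∷ʳ : ∀ l {z w} → Walk G l → last l ≡ just z → E z w → Walk G (l ∷ʳ w)
  walk-∷ʳ (x ∷ [])     _        refl e = e , tt
  walk-∷ʳ (x ∷ y ∷ l) (e′ , wl) lz   e = e′ , walk-∷ʳ (y ∷ l) wl lz e

  walk-reverse : ∀ l → Walk G l → Walk G (reverse l)
  walk-reverse []          w        = tt
  walk-reverse (x ∷ [])    w        = tt
  walk-reverse (x ∷ y ∷ l) (e , w) =
    subst (Walk G) (sym reverse-xyl)
      (walk-++ (reverse l) (subst (Walk G) (unfold-reverse y l) (walk-reverse (y ∷ l) w)) (E-sym e , tt))
    where
    reverse-xyl : reverse (x ∷ y ∷ l) ≡ reverse l ++ y ∷ [ x ]
    reverse-xyl = trans (unfold-reverse x (y ∷ l))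
                    (trans (cong (_∷ʳ x) (unfold-reverse y l)) (++-assoc (reverse l) [ y ] [ x ]))

  closedWalk⇒cycEdges : ∀ x xs → Walk G (x ∷ xs ++ [ x ]) → All (uncurry E) (cycEdges G (x ∷ xs))
  closedWalk⇒cycEdges x xs = go x xs
    where
    go : ∀ y ys → Walk G (y ∷ ys ++ [ x ]) → All (uncurry E) (zip (y ∷ ys) (ys ++ [ x ]))
    go y []       (e , _) = e ∷ All.[]
    go y (z ∷ zs) (e , w) = e ∷ go z zs w

  cycEdges⇒closedWalk : ∀ x xs → All (uncurry E) (cycEdges G (x ∷ xs)) → Walk G (x ∷ xs ++ [ x ])
  cycEdges⇒closedWalk x xs = go x xs
    where
    go : ∀ y ys → All (uncurry E) (zip (y ∷ ys) (ys ++ [ x ])) → Walk G (y ∷ ys ++ [ x ])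
    go y []       (e ∷ All.[]) = e , tt
    go y (z ∷ zs) (e ∷ es) = e , go z zs es

  private
    last-++ : ∀ {A : Set} (p : List A) x s → last (p ++ x ∷ s) ≡ last (x ∷ s)
    last-++ []           x s = refl
    last-++ (y ∷ [])     x s = refl
    last-++ (y ∷ z ∷ p)  x s = last-++ (z ∷ p) x s


  shortcut : ∀ x t → Walk G (x ∷ t) →
             ∃ λ t′ → Walk G (x ∷ t′) × Unique (x ∷ t′) × last (x ∷ t′) ≡ last (x ∷ t)
                    × (∀ {v} → v ∈ x ∷ t′ → v ∈ x ∷ t)
  shortcut x []      w       = [] , tt , (All.[] ∷ []) , refl , λ v∈ → v∈
  shortcut x (y ∷ t) (e , w) with shortcut y t w
  ... | t₁ , w₁ , u₁ , last₁ , sub₁ with x ∈? (y ∷ t₁)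
  ...   | no x∉ = y ∷ t₁ , (e , w₁) , (¬Any⇒All¬ _ x∉ ∷ u₁) , last₁ , sub
    where
    sub : ∀ {v} → v ∈ x ∷ y ∷ t₁ → v ∈ x ∷ y ∷ t
    sub (here v≡x)  = here v≡x
    sub (there v∈) = there (sub₁ v∈)
  ...   | yes x∈ with ∈-∃++ x∈
  ...     | p , s , eq =
    s , walk-++⁻ʳ p (subst (Walk G) eq w₁) , proj₁ (proj₂ (Unique-++⁻ p (subst Unique eq u₁)))
      , trans (sym (last-++ p x s)) (trans (cong last (sym eq)) last₁) , sub
    where
    sub : ∀ {v} → v ∈ x ∷ s → v ∈ x ∷ y ∷ t
    sub v∈ = there (sub₁ (subst (_ ∈_) (sym eq) (∈-++⁺ʳ p v∈)))

module Matchings (G : Graph) where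

  open Counting
  open import Data.Nat using (ℕ; _+_; _*_; _<ᵇ_; _≤_; zero; suc)
  open import Data.Nat.Properties using (+-identityʳ; *-monoʳ-≤)
  open import Data.Bool using (Bool; true; false; if_then_else_; not; _∧_; _∨_)
  open import Data.Fin using (Fin; toℕ; _≟_)
  open import Data.Fin.Properties using (toℕ-injective)
  open import Data.Fin.Permutation using (permutation)
  open import Data.Maybe using (Maybe; just; nothing; is-just; _<∣>_)
  open import Data.Product using (_×_; _,_; proj₁; proj₂; ∃)
  open import Data.Empty using (⊥)
  open import Function using (_∘_)
  open import Relation.Nullary using (does; contradiction)
  open import Relation.Nullary.Decidable using (dec-true; isYes≗does)
  open import Relation.Binary.PropositionalEquality
  open import Algebra.Properties.CommutativeMonoid.Sum Data.Nat.Properties.+-0-commutativeMonoid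
    using (sum; ∑-distrib-+; sum-cong-≗; sum-permute)

  open Graph G using (n; E; irrefl)

  saturated : Mate G → Fin n → Bool
  saturated M = is-just ∘ M

  saturated⇒just : ∀ {M x} → saturated M x ≡ true → ∃ λ y → M x ≡ just y
  saturated⇒just {M} {x} sat with M x
  ... | just y = y , refl

  ∥_∥ : Mate G → ℕ
  ∥ M ∥ = count (saturated M)

  module _ {M : Mate G} (M-matching : IsMatching G M) where

    private
      partner : Fin n → Fin n
      partner x with M x
      ... | nothing = x
      ... | just y  = y

      partner-involutive : ∀ x → partner (partner x) ≡ x
      partner-involutive x with M x in Mx
      ... | nothing rewrite Mx = refl
      ... | just y  rewrite proj₂ (M-matching x y Mx) = refl

      lowEnd′ : Fin n → Bool
      lowEnd′ x = lowEnd G x (M x)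

      highEnd : Fin n → Bool
      highEnd x with M x
      ... | nothing = false
      ... | just y  = toℕ y <ᵇ toℕ x

      highEnd≡lowEnd∘partner : ∀ x → bit (highEnd x) ≡ bit (lowEnd′ (partner x))
      highEnd≡lowEnd∘partner x with M x in Mx
      ... | nothing rewrite Mx = refl
      ... | just y  rewrite proj₂ (M-matching x y Mx) = refl

      <ᵇ-total : ∀ i j → i ≢ j → bit (i <ᵇ j) + bit (j <ᵇ i) ≡ 1
      <ᵇ-total zero    zero    i≢j = contradiction refl i≢j
      <ᵇ-total zero    (suc j) i≢j = refl
      <ᵇ-total (suc i) zero    i≢j = refl
      <ᵇ-total (suc i) (suc j) i≢j = <ᵇ-total i j (i≢j ∘ cong suc)

      saturated-split : ∀ x → bit (saturated M x) ≡ bit (lowEnd′ x) + bit (highEnd x)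
      saturated-split x with M x in Mx
      ... | nothing = refl
      ... | just y  = sym (<ᵇ-total (toℕ x) (toℕ y) λ x≡y →
                        irrefl (subst (E x) (sym (toℕ-injective x≡y)) (proj₁ (M-matching x y Mx))))

    -- size counts every edge at its lower end; the partner involution swaps lower and upper ends.
    2*size≡∥∥ : 2 * size G M ≡ ∥ M ∥
    2*size≡∥∥ = begin
      2 * size G M                                    ≡⟨ cong (2 *_) (length-filter-allFin lowEnd′) ⟩
      2 * count lowEnd′                               ≡⟨ cong (count lowEnd′ +_) (+-identityʳ _) ⟩
      count lowEnd′ + count lowEnd′                   ≡⟨ cong (count lowEnd′ +_) (sum-permute (bit ∘ lowEnd′) π) ⟩
      count lowEnd′ + sum (bit ∘ lowEnd′ ∘ partner)   ≡⟨ cong (count lowEnd′ +_) (sum-cong-≗ (sym ∘ highEnd≡lowEnd∘partner)) ⟩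
      count lowEnd′ + count highEnd                   ≡⟨ ∑-distrib-+ (bit ∘ lowEnd′) (bit ∘ highEnd) ⟨
      sum (λ x → bit (lowEnd′ x) + bit (highEnd x))   ≡⟨ sum-cong-≗ (sym ∘ saturated-split) ⟩
      ∥ M ∥                                           ∎
      where
      open ≡-Reasoning
      π = permutation partner partner partner-involutive partner-involutive

  maximum-∥∥ : ∀ {M} → IsMaximum G M → ∀ {M′} → IsMatching G M′ → ∥ M′ ∥ ≤ ∥ M ∥
  maximum-∥∥ (M-matching , M-max) M′-matching =
    subst₂ _≤_ (2*size≡∥∥ M′-matching) (2*size≡∥∥ M-matching) (*-monoʳ-≤ 2 (M-max _ M′-matching))

  Closed : Mate G → (Fin n → Bool) → Set
  Closed M A = ∀ {x y} → M x ≡ just y → A x ≡ true → A y ≡ true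

  private
    keepIn : (Fin n → Bool) → Maybe (Fin n) → Maybe (Fin n)
    keepIn A nothing  = nothing
    keepIn A (just y) = if A y then just y else nothing

  infixl 6 _↾_
  _↾_ : Mate G → (Fin n → Bool) → Mate G
  (M ↾ A) x = if A x then keepIn A (M x) else nothing

  infixl 5 _∪_
  _∪_ : Mate G → Mate G → Mate G
  (M ∪ N) x = M x <∣> N x

  Disjoint : Mate G → Mate G → Set
  Disjoint M N = ∀ x → saturated M x ≡ true → saturated N x ≡ true → ⊥

  module _ {M : Mate G} {A : Fin n → Bool} where

    ↾-just : ∀ {x y} → (M ↾ A) x ≡ just y → A x ≡ true × M x ≡ just y × A y ≡ true
    ↾-just {x} eq with A x in Ax | M x
    ... | true | just z with A z in Az
    ...   | true with refl ← eq = refl , refl , Az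

    ↾-keeps : ∀ {x y} → A x ≡ true → M x ≡ just y → A y ≡ true → (M ↾ A) x ≡ just y
    ↾-keeps Ax Mx Ay rewrite Ax | Mx | Ay = refl

    ↾-outside : ∀ {x} → A x ≡ false → (M ↾ A) x ≡ nothing
    ↾-outside Ax rewrite Ax = refl

    ↾-support : ∀ x → saturated (M ↾ A) x ≡ true → A x ≡ true
    ↾-support x sat with (M ↾ A) x in eq
    ... | just y = proj₁ (↾-just eq)

    ↾-matching : IsMatching G M → IsMatching G (M ↾ A)
    ↾-matching M-matching x y eq with ↾-just eq
    ... | Ax , Mx , Ay = proj₁ (M-matching x y Mx) , ↾-keeps Ay (proj₂ (M-matching x y Mx)) Ax

    ↾-agrees : Closed M A → ∀ {x} → A x ≡ true → (M ↾ A) x ≡ M x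
    ↾-agrees closed {x} Ax with M x in Mx
    ... | nothing rewrite Ax = refl
    ... | just y  rewrite Ax | closed Mx Ax = refl

    ↾-saturated : Closed M A → ∀ x → saturated (M ↾ A) x ≡ A x ∧ saturated M x
    ↾-saturated closed x = by-cases (A x) refl
      where
      by-cases : ∀ b → A x ≡ b → saturated (M ↾ A) x ≡ b ∧ saturated M x
      by-cases true  Ax = cong is-just (↾-agrees closed Ax)
      by-cases false Ax = cong is-just (↾-outside Ax)

    ∥↾∥ : Closed M A → ∥ M ↾ A ∥ ≡ count (λ x → A x ∧ saturated M x)
    ∥↾∥ closed = count-cong (↾-saturated closed)

  module _ {M N : Mate G} where

    ∪-saturated : ∀ x → saturated (M ∪ N) x ≡ saturated M x ∨ saturated N x
    ∪-saturated x with M x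
    ... | just _  = refl
    ... | nothing = refl

    ∪-left : ∀ {x y} → M x ≡ just y → (M ∪ N) x ≡ just y
    ∪-left Mx rewrite Mx = refl

    ∪-right : ∀ {x} → M x ≡ nothing → (M ∪ N) x ≡ N x
    ∪-right Mx rewrite Mx = refl

    ∪-matching : IsMatching G M → IsMatching G N → Disjoint M N → IsMatching G (M ∪ N)
    ∪-matching M-matching N-matching disjoint x y eq with M x in Mx
    ... | just z with refl ← eq = proj₁ (M-matching x y Mx) , ∪-left (proj₂ (M-matching x y Mx))
    ... | nothing = proj₁ (N-matching x y eq) , trans (∪-right My) (proj₂ (N-matching x y eq))
      where
      My : M y ≡ nothing
      My with M y in My
      ... | nothing = refl
      ... | just _  = contradiction (cong is-just My) λ satM →
                        disjoint y satM (cong is-just (proj₂ (N-matching x y eq)))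

    ∥∪∥ : Disjoint M N → ∥ M ∪ N ∥ ≡ ∥ M ∥ + ∥ N ∥
    ∥∪∥ disjoint = trans (count-cong ∪-saturated) (count-∨ disjoint)

  Closed-complement : ∀ {M A} → IsMatching G M → Closed M A → Closed M (not ∘ A)
  Closed-complement {A = A} M-matching closed {x} {y} Mx ¬Ax with A y in Ay
  ... | false = refl
  ... | true  = trans (sym (cong not (closed (proj₂ (M-matching x y Mx)) Ay))) ¬Ax

  module _ (M : Mate G) where

    inM⇒just : ∀ {a b} → inM G M a b ≡ true → M a ≡ just b
    inM⇒just {a} {b} eq with M a
    ... | just w with refl ← from-does (w ≟ b) (trans (sym (isYes≗does (w ≟ b))) eq) = refl

    just⇒inM : ∀ {a b} → M a ≡ just b → inM G M a b ≡ true
    just⇒inM {a} {b} eq with M a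
    just⇒inM {a} {b} refl | just w = trans (isYes≗does (w ≟ w)) (dec-true (w ≟ w) refl)

    ¬just⇒inM : ∀ {a b} → M a ≢ just b → inM G M a b ≡ false
    ¬just⇒inM {a} {b} ne with inM G M a b in eq
    ... | true  = contradiction (inM⇒just eq) ne
    ... | false = refl

    module _ (M-matching : IsMatching G M) where

      private
        inM-flip : ∀ {a b} → inM G M a b ≡ true → inM G M b a ≡ true
        inM-flip ab = just⇒inM (proj₂ (M-matching _ _ (inM⇒just ab)))

      inM-sym : ∀ a b → inM G M a b ≡ inM G M b a
      inM-sym a b with inM G M a b in ab | inM G M b a in ba
      ... | false | false = refl
      ... | true  | true  = refl
      ... | true  | false = contradiction (trans (sym ba) (inM-flip ab)) λ ()
      ... | false | true  = contradiction (trans (sym ab) (inM-flip ba)) λ ()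

    inM-just : ∀ {a y} → M a ≡ just y → ∀ b → inM G M a b ≡ does (y ≟ b)
    inM-just {a} Ma b with M a
    inM-just {a} refl b | just y = isYes≗does (y ≟ b)

    inM-nothing : ∀ {a} → M a ≡ nothing → ∀ b → inM G M a b ≡ false
    inM-nothing {a} Ma b with M a
    inM-nothing {a} refl b | nothing = refl

  inM-cong : ∀ {M M′ a} → M a ≡ M′ a → ∀ b → inM G M a b ≡ inM G M′ a b
  inM-cong {M} {M′} {a} eq b with M a | M′ a
  ... | nothing | nothing = refl
  ... | just w  | just w′ with refl ← eq = refl
  ... | nothing | just _  with () ← eq
  ... | just _  | nothing with () ← eq

module CycleMatching (G : Graph) where

  open Counting
  open import Data.Nat using (_+_; _*_; _≤_)
  open import Data.Nat.Properties
    using (+-identityʳ; ≤-reflexive; +-cancelʳ-≤; module ≤-Reasoning)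
  open import Data.Bool using (Bool; true; false; _∧_; _∨_; not)
  open import Data.Bool.Properties using (∧-identityʳ; ∧-zeroʳ)
  open import Data.Fin using (Fin; _≟_)
  open import Data.List using (List; []; _∷_; length)
  open import Data.List.Relation.Unary.Unique.Propositional using (Unique)
  import Data.List.Relation.Unary.Unique.Propositional.Properties as Unique
  open import Data.List.Membership.Propositional using (_∈_)
  open import Data.Maybe using (just; nothing)
  open import Data.Product using (_×_; _,_; proj₁; proj₂; ∃)
  open import Data.Empty using (⊥)
  open import Relation.Nullary using (does; yes; no; contradiction)
  open import Relation.Nullary.Decidable using (dec-true; dec-false)
  open import Relation.Binary.PropositionalEquality
  open import Algebra.Properties.CommutativeMonoid.Sum Data.Nat.Properties.+-0-commutativeMonoid
    using (sum; sum-cong-≗)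

  open CycleLists G
  open Matchings G

  open Graph G using (n)

  matchedAlong : Mate G → List (Fin n) → Fin n → Bool
  matchedAlong M c x with M x
  ... | nothing = false
  ... | just y  = does (CEdge? c x y)

  module _ {M : Mate G} (M-matching : IsMatching G M) {c : List (Fin n)} (unique-c : Unique c) (3≤c : 3 ≤ length c) where

    private
      L = cycEdges G c

      unique-L : Unique L
      unique-L = Unique.map⁻ (subst Unique (sym (map-proj₁-cycEdges c)) unique-c)

      forward backward : Fin n → Bool
      forward x with M x
      ... | nothing = false
      ... | just y  = does ((x , y) ∈²? L)
      backward x with M x
      ... | nothing = false
      ... | just y  = does ((y , x) ∈²? L)

      fibre-forward : ∀ x → countᴸ (λ e → does (x ≟ proj₁ e) ∧ inM G M (proj₁ e) (proj₂ e)) L ≡ bit (forward x)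
      fibre-forward x with M x in Mx
      ... | nothing = trans (countᴸ-cong L λ (a , b) _ → none a b) (countᴸ-false L)
        where
        none : ∀ a b → does (x ≟ a) ∧ inM G M a b ≡ false
        none a b with x ≟ a
        ... | yes refl = inM-nothing M Mx b
        ... | no  _    = refl
      ... | just y  = trans (countᴸ-cong L λ (a , b) _ → single a b) (countᴸ-≟ _≟²_ unique-L (x , y))
        where
        single : ∀ a b → does (x ≟ a) ∧ inM G M a b ≡ does ((x , y) ≟² (a , b))
        single a b with x ≟ a
        ... | yes refl = inM-just M Mx b
        ... | no  _    = refl

      fibre-backward : ∀ x → countᴸ (λ e → does (x ≟ proj₂ e) ∧ inM G M (proj₂ e) (proj₁ e)) L ≡ bit (backward x)
      fibre-backward x with M x in Mx
      ... | nothing = trans (countᴸ-cong L λ (a , b) _ → none a b) (countᴸ-false L)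
        where
        none : ∀ a b → does (x ≟ b) ∧ inM G M b a ≡ false
        none a b with x ≟ b
        ... | yes refl = inM-nothing M Mx a
        ... | no  _    = refl
      ... | just y  = trans (countᴸ-cong L λ (a , b) _ → single a b) (countᴸ-≟ _≟²_ unique-L (y , x))
        where
        single : ∀ a b → does (x ≟ b) ∧ inM G M b a ≡ does ((y , x) ≟² (a , b))
        single a b with x ≟ b
        ... | yes refl = trans (inM-just M Mx a) (sym (∧-identityʳ _))
        ... | no  _    = sym (∧-zeroʳ _)

      forward-backward-disjoint : ∀ x → forward x ≡ true → backward x ≡ true → ⊥
      forward-backward-disjoint x fwd bwd with M x
      ... | just y = cycEdges-asym unique-c 3≤c (from-does ((x , y) ∈²? L) fwd) (from-does ((y , x) ∈²? L) bwd)

      matchedAlong-split : ∀ x → forward x ∨ backward x ≡ matchedAlong M c x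
      matchedAlong-split x with M x
      ... | nothing = refl
      ... | just y  = refl

    -- Double counting: each M-edge of c is counted at both of its ends, and a vertex lies on at most one
    -- such edge, which c traverses in only one direction (cycEdges-asym).
    2*countM≡count-matchedAlong : 2 * countM G M c ≡ count (matchedAlong M c)
    2*countM≡count-matchedAlong = begin
      2 * countM G M c
        ≡⟨ cong (countM G M c +_) (+-identityʳ _) ⟩
      countᴸ edge L + countᴸ edge L
        ≡⟨ cong (countᴸ edge L +_) (countᴸ-cong L λ (a , b) _ → inM-sym M M-matching a b) ⟩
      countᴸ edge L + countᴸ (λ e → inM G M (proj₂ e) (proj₁ e)) L
        ≡⟨ cong₂ _+_ (countᴸ-by-fibres proj₁ edge L) (countᴸ-by-fibres proj₂ (λ e → inM G M (proj₂ e) (proj₁ e)) L) ⟩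
      sum (λ x → countᴸ (λ e → does (x ≟ proj₁ e) ∧ edge e) L)
        + sum (λ x → countᴸ (λ e → does (x ≟ proj₂ e) ∧ inM G M (proj₂ e) (proj₁ e)) L)
        ≡⟨ cong₂ _+_ (sum-cong-≗ fibre-forward) (sum-cong-≗ fibre-backward) ⟩
      count forward + count backward
        ≡⟨ count-∨ forward-backward-disjoint ⟨
      count (λ x → forward x ∨ backward x)
        ≡⟨ count-cong matchedAlong-split ⟩
      count (matchedAlong M c) ∎
      where
      open ≡-Reasoning
      edge : Fin n × Fin n → Bool
      edge e = inM G M (proj₁ e) (proj₂ e)

    matchedAlong⇒CEdge : ∀ {x} → matchedAlong M c x ≡ true → ∃ λ y → M x ≡ just y × CEdge G c x y
    matchedAlong⇒CEdge {x} along with M x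
    ... | just y = y , refl , from-does (CEdge? c x y) along

    CEdge⇒matchedAlong : ∀ {x y} → M x ≡ just y → CEdge G c x y → matchedAlong M c x ≡ true
    CEdge⇒matchedAlong {x} {y} Mx edge rewrite Mx = dec-true (CEdge? c x y) edge

    matchedAlong⊆cycle : ∀ x → matchedAlong M c x ≡ true → x ∈ᵇ c ≡ true
    matchedAlong⊆cycle x along with matchedAlong⇒CEdge along
    ... | _ , _ , edge = ∈⇒∈ᵇ c (CEdge-∈ edge)

    2*countM≤length : 2 * countM G M c ≤ length c
    2*countM≤length = begin
      2 * countM G M c          ≡⟨ 2*countM≡count-matchedAlong ⟩
      count (matchedAlong M c)  ≤⟨ count-mono matchedAlong⊆cycle ⟩
      count (_∈ᵇ c)             ≡⟨ count-∈ᵇ unique-c ⟩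
      length c                  ∎
      where open ≤-Reasoning

    saturated-cycle≤2*countM : (∀ {x y} → x ∈ c → M x ≡ just y → CEdge G c x y) →
                               count (λ x → x ∈ᵇ c ∧ saturated M x) ≤ 2 * countM G M c
    saturated-cycle≤2*countM chordless = begin
      count (λ x → x ∈ᵇ c ∧ saturated M x)  ≤⟨ count-mono along ⟩
      count (matchedAlong M c)                ≡⟨ 2*countM≡count-matchedAlong ⟨
      2 * countM G M c                        ∎
      where
      open ≤-Reasoning
      along : ∀ x → x ∈ᵇ c ∧ saturated M x ≡ true → matchedAlong M c x ≡ true
      along x sat with x ∈ᵇ c in x∈c
      ... | true with saturated⇒just {M} sat
      ...   | y , Mx = CEdge⇒matchedAlong Mx (chordless (∈ᵇ⇒∈ c x∈c) Mx)

    blossom-matchedAlong : ∀ {b} → length c ≡ 2 * countM G M c + 1 → b ∈ c → matchedAlong M c b ≡ false →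
                           ∀ {x} → x ∈ c → x ≢ b → matchedAlong M c x ≡ true
    blossom-matchedAlong {b} blossom b∈c b-free {x} x∈c x≢b =
      ⊆-count-≥⇒⊇ along⊆ (+-cancelʳ-≤ 1 _ _ counts) x
        (cong₂ _∧_ (∈⇒∈ᵇ c x∈c) (cong not (dec-false (x ≟ b) x≢b)))
      where
      others : Fin n → Bool
      others x = x ∈ᵇ c ∧ not (does (x ≟ b))
      along⊆ : ∀ x → matchedAlong M c x ≡ true → others x ≡ true
      along⊆ x along with x ≟ b
      ... | yes refl = contradiction (trans (sym along) b-free) λ ()
      ... | no  _    = trans (∧-identityʳ _) (matchedAlong⊆cycle x along)
      counts : count others + 1 ≤ count (matchedAlong M c) + 1
      counts = ≤-reflexive (begin
        count others + 1                 ≡⟨ count-without (_∈ᵇ c) (∈⇒∈ᵇ c b∈c) ⟩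
        count (_∈ᵇ c)                    ≡⟨ count-∈ᵇ unique-c ⟩
        length c                         ≡⟨ blossom ⟩
        2 * countM G M c + 1             ≡⟨ cong (_+ 1) 2*countM≡count-matchedAlong ⟩
        count (matchedAlong M c) + 1     ∎)
        where open ≡-Reasoning

module Pairing (G : Graph) where

  open ListFacts
  open Parity using (odd-suc⇒even)
  open Counting
  open import Data.Nat using (_%_)
  open import Data.Bool using (not; _∧_)
  open import Data.Bool.Properties using (∧-identityʳ)
  import Data.List.Relation.Unary.AllPairs as AllPairs
  open import Data.List.Relation.Unary.Unique.Propositional.Properties using (Unique[x∷xs]⇒x∉xs)
  open import Data.List.Relation.Binary.Permutation.Propositional.Properties
    using (↭-length; All-resp-↭)
  open import Data.Bool using (if_then_else_)
  open import Data.Fin using (Fin; _≟_)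
  open import Data.List using (List; []; _∷_; _++_; [_]; length)
  open import Data.List.Membership.Propositional using (_∈_; _∉_)
  open import Data.List.Relation.Unary.Any using (here; there)
  open import Data.List.Relation.Unary.Unique.Propositional using (Unique)
  open import Data.List.Relation.Unary.AllPairs using (_∷_)
  open import Data.List.Relation.Unary.All using (_∷_)
  open import Data.List.Relation.Unary.All.Properties using (All¬⇒¬Any)
  open import Data.Maybe using (just; nothing)
  open import Data.Product using (_×_; _,_; proj₁; ∃)
  open import Relation.Nullary using (yes; no; does; contradiction)
  open import Relation.Nullary.Decidable using (dec-true; dec-false)
  open import Relation.Binary.PropositionalEquality hiding ([_])

  open Matchings G
  open CycleLists G
  open Paths G

  open Graph G using (n; E) renaming (sym to E-sym)

  pairing : List (Fin n) → Mate G
  pairing (a ∷ b ∷ l) x = if does (x ≟ a) then just b else if does (x ≟ b) then just a else pairing l x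
  pairing _           x = nothing

  pairing-support : ∀ l {x y} → pairing l x ≡ just y → x ∈ l × y ∈ l
  pairing-support (a ∷ b ∷ l) {x} eq with x ≟ a | x ≟ b
  ... | yes refl | _        with refl ← eq = here refl , there (here refl)
  ... | no  _    | yes refl with refl ← eq = there (here refl) , here refl
  ... | no  _    | no  _    with pairing-support l eq
  ...   | x∈l , y∈l = there (there x∈l) , there (there y∈l)

  pairing-matching : ∀ l → Unique l → Walk G l → IsMatching G (pairing l)
  pairing-matching (a ∷ b ∷ l) (a∉ ∷ b∉ ∷ u) (ab , w) x y eq with x ≟ a | x ≟ b
  ... | yes refl | _ with refl ← eq
    rewrite dec-false (b ≟ a) (λ b≡a → All¬⇒¬Any a∉ (here (sym b≡a))) | dec-true (b ≟ b) refl = ab , refl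
  ... | no  _    | yes refl with refl ← eq rewrite dec-true (a ≟ a) refl = E-sym ab , refl
  ... | no  _    | no  _ with pairing-support l eq | pairing-matching l u (walk-tail l w) x y eq
  ...   | _ , y∈l | xy , yx
    rewrite dec-false (y ≟ a) (λ { refl → All¬⇒¬Any a∉ (there y∈l) })
          | dec-false (y ≟ b) (λ { refl → All¬⇒¬Any b∉ y∈l }) = xy , yx

  pairing-saturated : ∀ l → length l % 2 ≡ 0 → ∀ x → saturated (pairing l) x ≡ x ∈ᵇ l
  pairing-saturated []          _    x = refl
  pairing-saturated (a ∷ b ∷ l) even x with x ≟ a | x ≟ b
  ... | yes _ | _     = refl
  ... | no  _ | yes _ = refl
  ... | no  _ | no  _ = pairing-saturated l even x

  ∥pairing∥ : ∀ l → Unique l → length l % 2 ≡ 0 → ∥ pairing l ∥ ≡ length l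
  ∥pairing∥ l u even = trans (count-cong (pairing-saturated l even)) (count-∈ᵇ u)

  pairing-outside : ∀ l {x} → x ∉ l → pairing l x ≡ nothing
  pairing-outside l {x} x∉l with pairing l x in eq
  ... | nothing = refl
  ... | just _  = contradiction (proj₁ (pairing-support l eq)) x∉l

  cycle-near-perfect : ∀ {c v} → IsOddCycle G c → v ∈ c →
                       ∃ λ P → IsMatching G P × (∀ x → saturated P x ≡ x ∈ᵇ c ∧ not (does (x ≟ v)))
  cycle-near-perfect {c} {v} ((_ , unique-c , c-edges) , odd) v∈c with rotate-to v∈c
  ... | s , ρ = pairing s , pairing-matching s unique-s walk-s , λ x → trans (pairing-saturated s even x) (membership x)
    where
    open Rotation ρ
    unique-vs : Unique (v ∷ s)
    unique-vs = Unique-resp-↭ vertices unique-c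
    unique-s : Unique s
    unique-s = AllPairs.tail unique-vs
    walk-s : Walk G s
    walk-s = walk-++⁻ˡ s (walk-tail (s ++ [ v ]) (cycEdges⇒closedWalk v s (All-resp-↭ edges c-edges)))
    even : length s % 2 ≡ 0
    even = odd-suc⇒even (length s) (subst (λ m → m % 2 ≡ 1) (↭-length vertices) odd)
    membership : ∀ x → x ∈ᵇ s ≡ x ∈ᵇ c ∧ not (does (x ≟ v))
    membership x rewrite ∈ᵇ-resp-↭ vertices x with x ≟ v
    ... | yes refl = ∉⇒∈ᵇ s (Unique[x∷xs]⇒x∉xs unique-vs)
    ... | no  _    = sym (∧-identityʳ _)

module Stems (G : Graph) {M : Mate G} (M-matching : IsMatching G M) where

  open Parity using (even-suc⇒odd)
  open import Data.Nat using (_%_)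
  open import Data.Bool using (true; false)
  open import Data.Fin using (Fin)
  open import Data.List using (List; []; _∷_; length; last)
  open import Data.List.Membership.Propositional using (_∈_)
  open import Data.List.Relation.Unary.Any using (here; there)
  open import Data.Maybe using (just; nothing)
  open import Data.Maybe.Properties using (just-injective)
  open import Data.Product using (_,_; proj₂)
  open import Relation.Nullary using (contradiction)
  open import Function using (_∘_)
  open import Relation.Binary.PropositionalEquality

  open Matchings G

  open Graph G using (n)

  EndsUnsaturated : List (Fin n) → Set
  EndsUnsaturated l = ∀ w → last l ≡ just w → M w ≡ nothing

  private
    alternate : ∀ {a b} → a ≢ b → a ≡ true → b ≡ false
    alternate {b = false} _   _    = refl
    alternate {b = true}  a≢b refl = contradiction refl a≢b

    alternate′ : ∀ {a b} → a ≢ b → b ≡ false → a ≡ true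
    alternate′ {a = true}  _   _    = refl
    alternate′ {a = false} a≢b refl = contradiction refl a≢b

  alternating-first-edge : ∀ x₀ x₁ r → Alternating G M (x₀ ∷ x₁ ∷ r) → EndsUnsaturated (x₀ ∷ x₁ ∷ r) →
                    length r % 2 ≡ 1 → inM G M x₀ x₁ ≡ true
  alternating-first-edge x₀ x₁ (x₂ ∷ []) (≢₀ , _) free _ =
    alternate′ ≢₀ (¬just⇒inM M λ M₁ →
      contradiction (trans (sym (free x₂ refl)) (proj₂ (M-matching x₁ x₂ M₁))) λ ())
  alternating-first-edge x₀ x₁ (x₂ ∷ x₃ ∷ r) (≢₀ , ≢₁ , alt) free odd =
    alternate′ ≢₀ (alternate (≢₁ ∘ sym) (alternating-first-edge x₂ x₃ r alt free odd))

  alternating-closed : ∀ x₀ x₁ r → Alternating G M (x₀ ∷ x₁ ∷ r) → EndsUnsaturated (x₀ ∷ x₁ ∷ r) →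
                       inM G M x₀ x₁ ≡ true → ∀ {y z} → y ∈ x₀ ∷ x₁ ∷ r → M y ≡ just z → z ∈ x₀ ∷ x₁ ∷ r
  alternating-closed x₀ x₁ r alt free first (here refl) My =
    there (here (just-injective (trans (sym My) (inM⇒just M first))))
  alternating-closed x₀ x₁ r alt free first (there (here refl)) My =
    here (just-injective (trans (sym My) (proj₂ (M-matching x₀ x₁ (inM⇒just M first)))))
  alternating-closed x₀ x₁ (x₂ ∷ []) alt free first (there (there (here refl))) My =
    contradiction (trans (sym My) (free x₂ refl)) λ ()
  alternating-closed x₀ x₁ (x₂ ∷ x₃ ∷ r) (≢₀ , ≢₁ , alt) free first (there (there y∈)) My =
    there (there (alternating-closed x₂ x₃ r alt free third y∈ My))
    where
    third : inM G M x₂ x₃ ≡ true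
    third = alternate′ (λ eq → ≢₁ (sym eq)) (alternate ≢₀ first)

  stem-closed : ∀ b rest → Alternating G M (b ∷ rest) → EndsUnsaturated (b ∷ rest) → length rest % 2 ≡ 0 →
                ∀ {x y} → x ∈ b ∷ rest → M x ≡ just y → y ∈ b ∷ rest
  stem-closed b []      _   free _    (here refl) Mx = contradiction (trans (sym Mx) (free b refl)) λ ()
  stem-closed b (s ∷ r) alt free even =
    alternating-closed b s r alt free (alternating-first-edge b s r alt free (even-suc⇒odd (length r) even))

module Isolation (G : Graph) where

  open Parity
  open ListFacts
  open import Data.Nat using (suc; _+_; _%_; _≤_; s≤s; z≤n)
  open import Data.Nat.Properties using (+-suc)
  open import Data.Fin using (Fin)
  open import Data.List using (List; []; _∷_; _++_; [_]; _∷ʳ_; length; reverse)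
  open import Data.List.Properties
    using (++-assoc; length-++; unfold-reverse; reverse-++; length-reverse)
  open import Data.List.Membership.Propositional using (_∈_; _∉_)
  open import Data.List.Membership.Propositional.Properties using (∈-++⁺ˡ; ∈-++⁺ʳ; ∈-∃++)
  open import Data.List.Relation.Unary.Any using (here; there)
  open import Data.List.Relation.Unary.Unique.Propositional using (Unique)
  open import Data.List.Relation.Unary.Unique.Propositional.Properties using (++⁺)
  open import Data.List.Relation.Binary.Permutation.Propositional using (_↭_; ↭-sym)
  open import Data.List.Relation.Binary.Permutation.Propositional.Properties
    using (∷↭∷ʳ; ∈-resp-↭; ↭-reverse; ↭-length)
  open import Data.Product using (_×_; _,_; proj₁; proj₂; ∃)
  open import Data.Sum using (inj₁; inj₂)
  open import Function.Bundles using (Equivalence)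
  open import Relation.Nullary using (¬_; Dec; yes; no; contradiction)
  open import Relation.Nullary.Decidable using (_×-dec_; decidable-stable)
  open import Relation.Binary.PropositionalEquality hiding ([_])

  open CycleLists G
  open Paths G

  open Graph G using (n)

  splice : ∀ {a b} ys zs q → IsCycle G (a ∷ ys ++ b ∷ zs) →
           Unique q → (∀ {v} → v ∈ q → v ∉ a ∷ ys ++ b ∷ zs) → Walk G (a ∷ q ++ [ b ]) →
           (length q + length zs) % 2 ≡ 1 → IsOddCycle G (a ∷ q ++ b ∷ zs)
  splice {a} {b} ys zs q (_ , u , all-edges) uq q∉ wq odd =
    (3≤length , unique , closedWalk⇒cycEdges a (q ++ b ∷ zs) closed) , odd-length
    where
    ρ = rotation (a ∷ ys) (b ∷ zs)
    open Rotation ρ using (vertices)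

    walk-b : Walk G (b ∷ zs ++ [ a ])
    walk-b = walk-++⁻ʳ (a ∷ ys)
      (subst (λ l → Walk G (a ∷ l)) (++-assoc ys (b ∷ zs) [ a ]) (cycEdges⇒closedWalk a (ys ++ b ∷ zs) all-edges))

    closed : Walk G (a ∷ (q ++ b ∷ zs) ++ [ a ])
    closed = subst (λ l → Walk G (a ∷ l)) (sym (++-assoc q (b ∷ zs) [ a ])) (walk-++ (a ∷ q) wq walk-b)

    b-side : List (Fin n)
    b-side = b ∷ zs ++ [ a ]

    b-side-eq : b-side ++ ys ≡ b ∷ zs ++ a ∷ ys
    b-side-eq = cong (b ∷_) (++-assoc zs [ a ] ys)

    unique : Unique (a ∷ q ++ b ∷ zs)
    unique = Unique-resp-↭ (↭-sym (subst (λ l → a ∷ q ++ b ∷ zs ↭ l) (++-assoc q (b ∷ zs) [ a ])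
                                      (∷↭∷ʳ a (q ++ b ∷ zs))))
               (++⁺ uq (proj₁ (Unique-++⁻ b-side (subst Unique (sym b-side-eq) (Unique-resp-↭ vertices u))))
                    λ { {v} (v∈q , v∈b-side) →
                          q∉ v∈q (∈-resp-↭ (↭-sym vertices) (subst (v ∈_) b-side-eq (∈-++⁺ˡ v∈b-side))) })

    length-eq : length (a ∷ q ++ b ∷ zs) ≡ suc (suc (length q + length zs))
    length-eq = cong suc (trans (length-++ q) (+-suc (length q) (length zs)))

    odd-length : length (a ∷ q ++ b ∷ zs) % 2 ≡ 1
    odd-length = subst (λ m → m % 2 ≡ 1) (sym length-eq) odd

    3≤length : 3 ≤ length (a ∷ q ++ b ∷ zs)
    3≤length = subst (3 ≤_) (sym length-eq) (s≤s (s≤s (positive (length q + length zs) odd)))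
      where
      positive : ∀ m → m % 2 ≡ 1 → 1 ≤ m
      positive (suc m) _ = s≤s z≤n

  Isolated : List (Fin n) → Set
  Isolated c = ∀ {a b} q → a ∈ c → b ∈ c → a ≢ b → Unique q → (∀ {v} → v ∈ q → v ∉ c) →
               Walk G (a ∷ q ++ [ b ]) → q ≡ [] × CEdge G c a b

  private
    not-SameCycle : ∀ {c c′ a b} q → (∀ {v} → v ∈ q → v ∉ c) → (∀ {v} → v ∈ q → v ∈ c′) →
                    (q ≡ [] → CEdge G c′ a b) → ¬ (q ≡ [] × CEdge G c a b) → ¬ SameCycle G c c′
    not-SameCycle []      _  _  edge ¬chord same = ¬chord (refl , Equivalence.from (same _ _) (edge refl))
    not-SameCycle (v ∷ q) q∉ q⊆ _    _      same = q∉ (here refl) (SameCycle-∈ same (q⊆ (here refl)))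

    reverse-path : ∀ {A : Set} (a : A) q b → reverse (a ∷ q ++ [ b ]) ≡ b ∷ reverse q ++ [ a ]
    reverse-path a q b = trans (unfold-reverse a (q ++ [ b ])) (cong (_∷ʳ a) (reverse-++ q [ b ]))

  -- q closes a cycle with each of the two arcs of c between a and b, and one of them is odd; it differs
  -- from c because it contains a vertex of q or, when q is empty, the chord ab.
  outside-path⇒odd-cycle : ∀ {c a b} q → IsOddCycle G c → a ∈ c → b ∈ c → a ≢ b →
                           Unique q → (∀ {v} → v ∈ q → v ∉ c) → Walk G (a ∷ q ++ [ b ]) →
                           ¬ (q ≡ [] × CEdge G c a b) →
                           ∃ λ c′ → IsOddCycle G c′ × a ∈ c′ × ¬ SameCycle G c c′
  outside-path⇒odd-cycle {c} {a} {b} q (cycle , odd) a∈c b∈c a≢b uq q∉c wq ¬chord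
    with rotate-to a∈c
  ... | s , ρ with ∈-resp-↭ (Rotation.vertices ρ) b∈c
  ...   | here b≡a = contradiction (sym b≡a) a≢b
  ...   | there b∈s with ∈-∃++ b∈s
  ...     | ys , zs , refl with odd-split (length ys) (length zs) (length q) ys+zs-odd
    where
    ys+zs-odd : (length ys + length zs) % 2 ≡ 1
    ys+zs-odd = subst (λ m → m % 2 ≡ 1)
                  (trans (↭-length (Rotation.vertices ρ))
                         (cong suc (trans (length-++ ys) (+-suc (length ys) (length zs)))))
                  odd
  ... | inj₁ q+zs-odd =
    a ∷ q ++ b ∷ zs , splice ys zs q r-cycle uq q∉r wq q+zs-odd , here refl ,
    not-SameCycle q q∉c (λ v∈q → there (∈-++⁺ˡ v∈q)) (λ { refl → inj₁ (here refl) }) ¬chord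
    where
    r-cycle = IsCycle-rotate ρ cycle
    q∉r : ∀ {v} → v ∈ q → v ∉ a ∷ ys ++ b ∷ zs
    q∉r v∈q v∈r = q∉c v∈q (∈-resp-↭ (↭-sym (Rotation.vertices ρ)) v∈r)
  ... | inj₂ q+ys-odd =
    b ∷ reverse q ++ a ∷ ys ,
    splice zs ys (reverse q) r′-cycle (Unique-resp-↭ (↭-sym (↭-reverse q)) uq) q′∉r′
      (subst (Walk G) (reverse-path a q b) (walk-reverse (a ∷ q ++ [ b ]) wq))
      (subst (λ m → (m + length ys) % 2 ≡ 1) (sym (length-reverse q)) q+ys-odd) ,
    there (∈-++⁺ʳ (reverse q) (here refl)) ,
    not-SameCycle q q∉c (λ v∈q → there (∈-++⁺ˡ (∈-resp-↭ (↭-sym (↭-reverse q)) v∈q)))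
      (λ { refl → inj₂ (here refl) }) ¬chord
    where
    ρ′ = rotation (a ∷ ys) (b ∷ zs)
    r′-cycle = IsCycle-rotate ρ′ (IsCycle-rotate ρ cycle)
    q′∉r′ : ∀ {v} → v ∈ reverse q → v ∉ b ∷ zs ++ a ∷ ys
    q′∉r′ v∈q′ v∈r′ = q∉c (∈-resp-↭ (↭-reverse q) v∈q′)
      (∈-resp-↭ (↭-sym (Rotation.vertices ρ)) (∈-resp-↭ (↭-sym (Rotation.vertices ρ′)) v∈r′))

  module _ (rd : RDisjoint G) where

    cycle⊆R : ∀ {c x} → IsOddCycle G c → x ∈ c → R G c x
    cycle⊆R oc x∈c with proj₁ (proj₂ rd) _ oc
    ... | _ , (M , c₀ , b , rest , M-max , same , flower , _) =
      M , c₀ , b , rest , M-max , same , flower , inj₁ (SameCycle-∈ same x∈c)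

    RDisjoint⇒Isolated : ∀ {c} → IsOddCycle G c → Isolated c
    RDisjoint⇒Isolated {c} oc {a} {b} q a∈c b∈c a≢b uq q∉c wq =
      decidable-stable (empty? q ×-dec CEdge? c a b) separated
      where
      empty? : (l : List (Fin n)) → Dec (l ≡ [])
      empty? []      = yes refl
      empty? (_ ∷ _) = no λ ()
      separated : ¬ ¬ (q ≡ [] × CEdge G c a b)
      separated ¬chord with outside-path⇒odd-cycle q oc a∈c b∈c a≢b uq q∉c wq ¬chord
      ... | c′ , oc′ , a∈c′ , c≉c′ =
        proj₂ (proj₂ rd) _ _ oc oc′ c≉c′ a (cycle⊆R oc a∈c) (cycle⊆R oc′ a∈c′)

module Flowers (G : Graph) where

  open Counting
  open import Data.Nat using (ℕ; suc; _+_; _*_; _%_; _≤_; _<_)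
  open import Data.Nat.Properties using (+-monoˡ-≤; ≤-antisym; module ≤-Reasoning)
  open import Data.Nat.Tactic.RingSolver using (solve-∀)
  open import Data.Bool using (Bool; true; false; not; _∧_; _∨_)
  open import Data.Bool.Properties using (∨-zeroʳ; ∧-zeroʳ; ∧-conicalˡ)
  import Data.List.Relation.Unary.AllPairs as AllPairs
  open import Data.Fin using (Fin; _≟_)
  open import Data.List using (List; []; _∷_; length; last)
  open import Data.List.Membership.Propositional using (_∈_; _∉_)
  open import Data.List.Relation.Unary.Any using (here; there)
  open import Data.List.Relation.Unary.Unique.Propositional using (Unique)
  open import Data.List.Relation.Unary.Unique.Propositional.Properties using (Unique[x∷xs]⇒x∉xs)
  open import Data.Maybe using (just; nothing; is-just)
  open import Data.Maybe.Properties using (just-injective)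
  open import Data.Product using (_×_; _,_; proj₁; proj₂; ∃)
  open import Function using (_∘_)
  open import Relation.Nullary using (yes; no; contradiction)
  open import Relation.Binary.PropositionalEquality

  open CycleLists G
  open Matchings G
  open CycleMatching G
  open Pairing G
  open Paths G

  open Graph G using (n)

  module FlowerMatching {M : Mate G} {c : List (Fin n)} {b : Fin n} {rest : List (Fin n)} {w : Fin n}
    (M-matching : IsMatching G M)
    (unique-c : Unique c) (3≤c : 3 ≤ length c) (blossom : length c ≡ 2 * countM G M c + 1)
    (b∈c : b ∈ c) (base : ∀ u → CEdge G c b u → inM G M b u ≡ false × inM G M u b ≡ false)
    (unique-stem : Unique (b ∷ rest)) (walk-stem : Walk G (b ∷ rest)) (alternating : Alternating G M (b ∷ rest))
    (even : length rest % 2 ≡ 0) (ends-at-w : last (b ∷ rest) ≡ just w) (w-free : M w ≡ nothing)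
    (stem-meets-c : ∀ x → x ∈ b ∷ rest → x ∈ c → x ≡ b)
    where

    open Stems G M-matching

    ends-unsaturated : EndsUnsaturated (b ∷ rest)
    ends-unsaturated w′ ends′ = subst (λ v → M v ≡ nothing) (just-injective (trans (sym ends-at-w) ends′)) w-free

    base-unmatched : matchedAlong M c b ≡ false
    base-unmatched with matchedAlong M c b in along
    ... | false = refl
    ... | true with matchedAlong⇒CEdge M-matching unique-c 3≤c along
    ...   | y , Mb , edge = contradiction (trans (sym (just⇒inM M Mb)) (proj₁ (base y edge))) λ ()

    blossom-closed : ∀ {x y} → x ∈ c → x ≢ b → M x ≡ just y → y ∈ c
    blossom-closed x∈c x≢b Mx
      with matchedAlong⇒CEdge M-matching unique-c 3≤c
             (blossom-matchedAlong M-matching unique-c 3≤c blossom b∈c base-unmatched x∈c x≢b)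
    ... | y , Mx′ , edge with refl ← trans (sym Mx) Mx′ = CEdge-∈ (CEdge-sym {c} edge)

    inside : Fin n → Bool
    inside x = x ∈ᵇ c ∨ x ∈ᵇ rest

    private
      stem-closed′ : ∀ {x y} → x ∈ b ∷ rest → M x ≡ just y → y ∈ b ∷ rest
      stem-closed′ = stem-closed b rest alternating ends-unsaturated even

      rest∉c : ∀ {x} → x ∈ rest → x ∉ c
      rest∉c x∈rest x∈c with refl ← stem-meets-c _ (there x∈rest) x∈c =
        Unique[x∷xs]⇒x∉xs unique-stem x∈rest

      inside-stem : ∀ {x} → x ∈ b ∷ rest → inside x ≡ true
      inside-stem (here refl)    = cong (_∨ _) (∈⇒∈ᵇ c b∈c)
      inside-stem (there x∈rest) = trans (cong (_∨ _) (∉⇒∈ᵇ c (rest∉c x∈rest))) (∈⇒∈ᵇ rest x∈rest)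

    inside-closed : Closed M inside
    inside-closed {x} {y} Mx x-inside with x ∈ᵇ c in x∈c
    ... | false = inside-stem (stem-closed′ (there (∈ᵇ⇒∈ rest x-inside)) Mx)
    ... | true with x ≟ b
    ...   | yes refl = inside-stem (stem-closed′ (here refl) Mx)
    ...   | no  x≢b  = cong (_∨ _) (∈⇒∈ᵇ c (blossom-closed (∈ᵇ⇒∈ c x∈c) x≢b Mx))

    avoiding : Mate G
    avoiding = (M ↾ (not ∘ inside)) ∪ pairing rest

    private
      disjoint : Disjoint (M ↾ (not ∘ inside)) (pairing rest)
      disjoint x sat₁ sat₂ with saturated⇒just {pairing rest} sat₂
      ... | _ , paired =
        contradiction (trans (sym (↾-support {M = M} {A = not ∘ inside} x sat₁))
                             (cong not (inside-stem (there (proj₁ (pairing-support rest paired)))))) λ ()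

    avoiding-matching : IsMatching G avoiding
    avoiding-matching =
      ∪-matching (↾-matching M-matching)
                 (pairing-matching rest (AllPairs.tail unique-stem) (walk-tail rest walk-stem))
                 disjoint

    avoiding-avoids : ∀ {x} → x ∈ c → avoiding x ≡ nothing
    avoiding-avoids {x} x∈c =
      trans (∪-right {M = M ↾ (not ∘ inside)} {N = pairing rest}
                     (↾-outside {M = M} {A = not ∘ inside} (cong not (cong (_∨ x ∈ᵇ rest) (∈⇒∈ᵇ c x∈c)))))
            (pairing-outside rest λ x∈rest → rest∉c x∈rest x∈c)

    private
      saturated-inside : ℕ
      saturated-inside = count (λ x → inside x ∧ saturated M x)

      saturated-outside : ℕ
      saturated-outside = count (λ x → not (inside x) ∧ saturated M x)

      ∥avoiding∥ : ∥ avoiding ∥ ≡ saturated-outside + length rest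
      ∥avoiding∥ = trans (∥∪∥ disjoint)
        (cong₂ _+_ (∥↾∥ (Closed-complement M-matching inside-closed)) (∥pairing∥ rest (AllPairs.tail unique-stem) even))

      count-inside : count inside ≡ length c + length rest
      count-inside = trans (count-∨ {p = _∈ᵇ c} {q = _∈ᵇ rest}
                                    (λ x x∈c x∈rest → rest∉c (∈ᵇ⇒∈ rest x∈rest) (∈ᵇ⇒∈ c x∈c)))
                           (cong₂ _+_ (count-∈ᵇ unique-c) (count-∈ᵇ (AllPairs.tail unique-stem)))

      w-inside : inside w ≡ true
      w-inside = inside-stem (last-∈ (b ∷ rest) ends-at-w)
        where
        last-∈ : ∀ (l : List (Fin n)) {v} → last l ≡ just v → v ∈ l
        last-∈ (x ∷ [])     refl = here refl
        last-∈ (x ∷ y ∷ l) eq   = there (last-∈ (y ∷ l) eq)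

      saturated-inside<count-inside : saturated-inside < count inside
      saturated-inside<count-inside =
        count-mono-< (λ x → ∧-conicalˡ (inside x) (saturated M x)) w
                     (trans (cong (λ m → inside w ∧ is-just m) w-free) (∧-zeroʳ _)) w-inside

    -- Blossom and stem are M-closed and cover all of their |c| + |rest| vertices but the free end w;
    -- re-pairing the stem behind the base gives back |rest| of them.
    ∥∥-avoiding : ∥ M ∥ + 1 ≤ ∥ avoiding ∥ + length c
    ∥∥-avoiding = begin
      ∥ M ∥ + 1                                    ≡⟨ cong (_+ 1) (count-partition inside (saturated M)) ⟩
      saturated-inside + saturated-outside + 1     ≡⟨ move-one saturated-inside saturated-outside ⟩
      suc saturated-inside + saturated-outside     ≤⟨ +-monoˡ-≤ saturated-outside saturated-inside<count-inside ⟩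
      count inside + saturated-outside             ≡⟨ cong (_+ saturated-outside) count-inside ⟩
      length c + length rest + saturated-outside   ≡⟨ regroup (length c) (length rest) saturated-outside ⟩
      (saturated-outside + length rest) + length c ≡⟨ cong (_+ length c) ∥avoiding∥ ⟨
      ∥ avoiding ∥ + length c                      ∎
      where
      open ≤-Reasoning
      move-one : ∀ a b → a + b + 1 ≡ suc a + b
      move-one = solve-∀
      regroup : ∀ a b c → a + b + c ≡ (c + b) + a
      regroup = solve-∀

  flower⇒avoiding-matching : ∀ {M c b rest} → IsMatching G M → IsFlower G M c b rest →
    ∃ λ N → IsMatching G N × (∀ {x} → x ∈ c → N x ≡ nothing) × ∥ M ∥ + 1 ≤ ∥ N ∥ + length c
  flower⇒avoiding-matching M-matching
    (((3≤c , unique-c , _) , blossom) , (b∈c , base) ,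
     (unique-stem , walk-stem , alternating , even , (w , ends-at-w , w-free) , meets)) =
    avoiding , avoiding-matching , avoiding-avoids , ∥∥-avoiding
    where
    open FlowerMatching M-matching unique-c 3≤c blossom b∈c base unique-stem walk-stem alternating even ends-at-w w-free meets

  RDisjoint⇒avoiding-matching : RDisjoint G → ∀ {M c} → IsMaximum G M → IsOddCycle G c →
    ∃ λ N → IsMatching G N × (∀ {x} → x ∈ c → N x ≡ nothing) × ∥ M ∥ + 1 ≤ ∥ N ∥ + length c
  RDisjoint⇒avoiding-matching rd {M} {c} M-max oc@((_ , unique-c , _) , _)
    with proj₁ (proj₂ rd) c oc
  ... | _ , M₀ , c₀ , _ , _ , M₀-max , same , flower@(((_ , unique-c₀ , _) , _) , _) , _
    with flower⇒avoiding-matching (proj₁ M₀-max) flower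
  ... | N , N-matching , N-avoids , N-large =
    N , N-matching , (λ x∈c → N-avoids (SameCycle-∈ same x∈c)) ,
    subst₂ (λ k l → k + 1 ≤ ∥ N ∥ + l) ∥M₀∥≡∥M∥ length-c₀≡length-c N-large
    where
    ∥M₀∥≡∥M∥ : ∥ M₀ ∥ ≡ ∥ M ∥
    ∥M₀∥≡∥M∥ = ≤-antisym (maximum-∥∥ M-max (proj₁ M₀-max)) (maximum-∥∥ M₀-max (proj₁ M-max))
    length-c₀≡length-c : length c₀ ≡ length c
    length-c₀≡length-c = begin
      length c₀       ≡⟨ count-∈ᵇ unique-c₀ ⟨
      count (_∈ᵇ c₀)  ≡⟨ count-cong {p = _∈ᵇ c₀} {q = _∈ᵇ c} same-vertices ⟩
      count (_∈ᵇ c)   ≡⟨ count-∈ᵇ unique-c ⟩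
      length c        ∎
      where
      open ≡-Reasoning
      same-vertices : ∀ x → x ∈ᵇ c₀ ≡ x ∈ᵇ c
      same-vertices x = ∈ᵇ-cong (SameCycle-∈ (SameCycle-sym {c₀} {c} same)) (SameCycle-∈ {c₀} {c} same)

module Closure {n : ℕ} (step : (Fin n → Bool) → Fin n → Bool)
  (inflationary : ∀ A x → A x ≡ true → step A x ≡ true)
  (extensional : ∀ {A B} → (∀ x → A x ≡ B x) → ∀ x → step A x ≡ step B x)
  where

  open Counting
  open import Data.Nat using (ℕ; zero; suc; _≤_; _<_; z≤n; s≤s)
  open import Data.Nat.Properties using (≤-trans; <-irrefl; ≤-<-trans)
  open import Data.Bool using (Bool; true; false; not; _∧_)
  open import Data.Fin using (Fin)
  open import Data.Sum using (_⊎_; inj₁; inj₂)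
  open import Data.Product using (_,_)
  open import Relation.Nullary using (contradiction)
  open import Relation.Binary.PropositionalEquality

  iterate : ℕ → (Fin n → Bool) → Fin n → Bool
  iterate zero    A = A
  iterate (suc i) A = step (iterate i A)

  Stable : (Fin n → Bool) → Set
  Stable B = ∀ x → step B x ≡ B x

  private
    stable-or-grows : ∀ B → Stable B ⊎ count B < count (step B)
    stable-or-grows B with count (λ x → step B x ∧ not (B x)) in new
    ... | zero  = inj₁ λ x → no-new x (count≡0 _ new x)
      where
      no-new : ∀ x → step B x ∧ not (B x) ≡ false → step B x ≡ B x
      no-new x eq with B x in Bx | step B x in sBx
      ... | true  | true  = refl
      ... | true  | false = contradiction (trans (sym sBx) (inflationary B x Bx)) λ ()
      ... | false | false = refl
    ... | suc _ with count>0 _ (subst (0 <_) (sym new) (s≤s z≤n))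
    ...   | x , fresh = inj₂ (count-mono-< (inflationary B) x (∧-not fresh) (∧-left fresh))
      where
      ∧-left : ∀ {a b} → a ∧ b ≡ true → a ≡ true
      ∧-left {true} _ = refl
      ∧-not : ∀ {a b} → a ∧ not b ≡ true → b ≡ false
      ∧-not {true} {false} _ = refl

    stable-next : ∀ {B} → Stable B → Stable (step B)
    stable-next stable = extensional stable

    stable-or-large : ∀ A i → Stable (iterate i A) ⊎ i ≤ count (iterate i A)
    stable-or-large A zero    = inj₂ z≤n
    stable-or-large A (suc i) with stable-or-large A i
    ... | inj₁ stable = inj₁ (stable-next stable)
    ... | inj₂ large with stable-or-grows (iterate i A)
    ...   | inj₁ stable = inj₁ (stable-next stable)
    ...   | inj₂ grows  = inj₂ (≤-<-trans large grows)

  opaque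
    -- Until the iteration stabilises every step adds a vertex, so n + 1 steps are enough.
    closure : (Fin n → Bool) → Fin n → Bool
    closure = iterate (suc n)

    closure-stable : ∀ A → Stable (closure A)
    closure-stable A with stable-or-large A (suc n)
    ... | inj₁ stable = stable
    ... | inj₂ large  = contradiction (≤-trans large (count≤n (closure A))) (<-irrefl refl)

    closure-⊇ : ∀ A x → A x ≡ true → closure A x ≡ true
    closure-⊇ A x Ax = go (suc n)
      where
      go : ∀ i → iterate i A x ≡ true
      go zero    = Ax
      go (suc i) = inflationary (iterate i A) x (go i)

    closure-ind : ∀ {A} (P : Fin n → Set) → (∀ x → A x ≡ true → P x) →
                  (∀ B → (∀ x → B x ≡ true → P x) → ∀ x → step B x ≡ true → P x) →
                  ∀ x → closure A x ≡ true → P x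
    closure-ind {A} P base next = go (suc n)
      where
      go : ∀ i x → iterate i A x ≡ true → P x
      go zero    = base
      go (suc i) = next (iterate i A) (go i)

module Exchange (G : Graph) {c : List (Fin (Graph.n G))} (odd-cycle : IsOddCycle G c)
  (isolated : Isolation.Isolated G c)
  {N : Mate G} (N-matching : IsMatching G N) (N-avoids : ∀ {x} → x ∈ c → N x ≡ nothing)
  (S : ℕ) (S-max : ∀ {M} → IsMatching G M → Matchings.∥_∥ G M ≤ S)
  (N-large : S + 1 ≤ Matchings.∥_∥ G N + length c) where

  open Counting
  open ListFacts
  open Parity
  open import Data.Nat using (ℕ; zero; suc; _+_; _*_; _≤_; _<_; ⌊_/2⌋; s≤s; z≤n)
  open import Data.Nat.Properties
    using (+-comm; +-mono-≤; +-monoˡ-≤; +-monoʳ-≤; +-cancelʳ-≤; *-cancelˡ-≤; +-cancelʳ-≡; module ≤-Reasoning)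
  open import Data.Nat.Tactic.RingSolver using (solve-∀)
  open import Data.Nat.Induction using (<-rec)
  open import Data.Bool using (Bool; true; false; not; _∧_; _∨_)
  open import Data.Bool.Properties
    using (∧-zeroʳ; ∨-zeroʳ; ∨-identityʳ; ∧-conicalˡ; ∧-conicalʳ; ∨-conicalˡ; not-injective)
  open import Data.Fin using (Fin; _≟_)
  open import Data.List using (List; []; _∷_; _++_; [_]; length; last)
  open import Data.List.Membership.Propositional using (_∈_; _∉_)
  open import Data.List.Relation.Unary.Any using (here; there)
  open import Data.Maybe using (Maybe; just; nothing)
  open import Data.Product using (_×_; _,_; proj₁; proj₂; ∃)
  open import Data.Sum using (_⊎_; inj₁; inj₂)
  open import Data.Empty using (⊥)
  open import Data.Unit using (tt)
  open import Data.List.Relation.Unary.AllPairs using ([])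
  open import Function using (_∘_)
  open import Relation.Nullary using (Dec; yes; no; does; contradiction)
  open import Relation.Nullary.Decidable using (dec-true; dec-false)
  open import Relation.Binary.PropositionalEquality hiding ([_])

  open Graph G using (n; E; irrefl) renaming (sym to E-sym)
  open CycleLists G
  open Paths G
  open Matchings G
  open CycleMatching G
  open Pairing G

  private
    unique-c = proj₁ (proj₂ (proj₁ odd-cycle))
    3≤c = proj₁ (proj₁ odd-cycle)

    exchange-arith : ∀ m a b d e p → d + p + e ≤ m → m ≤ d + b → m + 1 ≤ (a + e) + (p + 1) → m ≤ a + b
    exchange-arith m a b d e p dpe≤m m≤db m<aep1 = +-cancelʳ-≤ m m (a + b) (begin
      m + m                  ≤⟨ +-mono-≤ m≤aep m≤db ⟩
      (a + e + p) + (d + b)  ≡⟨ regroup a b d e p ⟩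
      (a + b) + (d + p + e)  ≤⟨ +-monoʳ-≤ (a + b) dpe≤m ⟩
      (a + b) + m            ∎)
      where
      open ≤-Reasoning
      regroup : ∀ a b d e p → (a + e + p) + (d + b) ≡ (a + b) + (d + p + e)
      regroup = solve-∀
      shift : ∀ a e p → (a + e) + (p + 1) ≡ (a + e + p) + 1
      shift = solve-∀
      m≤aep : m ≤ a + e + p
      m≤aep = +-cancelʳ-≤ 1 m (a + e + p) (subst (m + 1 ≤_) (shift a e p) m<aep1)

  leaves : Fin n → Maybe (Fin n) → Bool
  leaves x nothing  = false
  leaves x (just y) = x ∈ᵇ c ∧ not (y ∈ᵇ c)

  crossing : Mate G → Fin n → Bool
  crossing M x = leaves x (M x)

  module _ {M : Mate G} (M-matching : IsMatching G M) (M-large : S ≤ ∥ M ∥) where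

    chord-free : ∀ {x y} → x ∈ c → y ∈ c → M x ≡ just y → CEdge G c x y
    chord-free {x} {y} x∈c y∈c Mx =
      proj₂ (isolated [] x∈c y∈c x≢y [] (λ ()) (proj₁ (M-matching x y Mx) , tt))
      where
      x≢y : x ≢ y
      x≢y refl = irrefl (proj₁ (M-matching x x Mx))

    module Uncrossed (uncrossed : count (crossing M) ≡ 0) where

      stays : ∀ {x y} → x ∈ c → M x ≡ just y → y ∈ c
      stays {x} {y} x∈c Mx = ∈ᵇ⇒∈ c (not-injective (stays-false (count≡0 (crossing M) uncrossed x)))
        where
        stays-false : leaves x (M x) ≡ false → not (y ∈ᵇ c) ≡ false
        stays-false eq rewrite Mx | ∈⇒∈ᵇ c x∈c = eq

      private
        outside : Fin n → Bool
        outside x = not (x ∈ᵇ c)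

        closed-outside : Closed M outside
        closed-outside = Closed-complement M-matching λ Mx x∈c → ∈⇒∈ᵇ c (stays (∈ᵇ⇒∈ c x∈c) Mx)

        some-vertex : ∃ λ v → v ∈ c
        some-vertex = first c 3≤c
          where
          first : ∀ l → 3 ≤ length l → ∃ λ v → v ∈ l
          first (v ∷ _) _ = v , here refl

        v = proj₁ some-vertex
        v∈c = proj₂ some-vertex

        P = proj₁ (cycle-near-perfect odd-cycle v∈c)
        P-matching = proj₁ (proj₂ (cycle-near-perfect odd-cycle v∈c))
        P-saturated = proj₂ (proj₂ (cycle-near-perfect odd-cycle v∈c))

        disjoint : Disjoint (M ↾ outside) P
        disjoint x sat₁ sat₂ =
          contradiction (trans (sym (↾-support {M = M} {A = outside} x sat₁))
                               (cong not (∧-conicalˡ _ _ (trans (sym (P-saturated x)) sat₂)))) λ ()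

        ∥P∥+1≡length : ∥ P ∥ + 1 ≡ length c
        ∥P∥+1≡length = trans (cong (_+ 1) (count-cong P-saturated))
                              (trans (count-without (_∈ᵇ c) (∈⇒∈ᵇ c v∈c)) (count-∈ᵇ unique-c))

        saturated-outside : ℕ
        saturated-outside = count (λ x → outside x ∧ saturated M x)

        ∥P∥≤2*countM : ∥ P ∥ ≤ 2 * countM G M c
        ∥P∥≤2*countM = +-cancelʳ-≤ saturated-outside _ _ (begin
          ∥ P ∥ + saturated-outside
            ≡⟨ +-comm ∥ P ∥ saturated-outside ⟩
          saturated-outside + ∥ P ∥
            ≡⟨ cong (_+ ∥ P ∥) (∥↾∥ closed-outside) ⟨
          ∥ M ↾ outside ∥ + ∥ P ∥
            ≡⟨ ∥∪∥ disjoint ⟨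
          ∥ (M ↾ outside) ∪ P ∥
            ≤⟨ S-max (∪-matching (↾-matching M-matching) P-matching disjoint) ⟩
          S
            ≤⟨ M-large ⟩
          ∥ M ∥
            ≡⟨ count-partition (_∈ᵇ c) (saturated M) ⟩
          count (λ x → x ∈ᵇ c ∧ saturated M x) + saturated-outside
            ≤⟨ +-monoˡ-≤ saturated-outside (saturated-cycle≤2*countM M-matching unique-c 3≤c
                                              λ x∈c Mx → chord-free x∈c (stays x∈c Mx) Mx) ⟩
          2 * countM G M c + saturated-outside ∎)
          where open ≤-Reasoning

      half≤countM : ⌊ length c /2⌋ ≤ countM G M c
      half≤countM = *-cancelˡ-≤ 2 (subst (_≤ 2 * countM G M c) ∥P∥≡2*half ∥P∥≤2*countM)
        where
        ∥P∥≡2*half : ∥ P ∥ ≡ 2 * ⌊ length c /2⌋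
        ∥P∥≡2*half = +-cancelʳ-≡ 1 _ _ (trans ∥P∥+1≡length (odd⇒≡2*⌊/2⌋+1 (length c) (proj₂ odd-cycle)))

    module Uncross {x₀ u : Fin n} (x₀∈c : x₀ ∈ c) (M-x₀ : M x₀ ≡ just u) (u∉c : u ∉ c) where

      private
        partnerIn : Mate G → (Fin n → Bool) → Fin n → Bool
        partnerIn M′ B y with M′ y
        ... | nothing = false
        ... | just z  = B z

        partnerIn-cong : ∀ M′ {A B : Fin n → Bool} → (∀ x → A x ≡ B x) → ∀ y → partnerIn M′ A y ≡ partnerIn M′ B y
        partnerIn-cong M′ A≗B y with M′ y
        ... | nothing = refl
        ... | just z  = A≗B z

        partnerIn-true : ∀ M′ {B y} → partnerIn M′ B y ≡ true → ∃ λ z → M′ y ≡ just z × B z ≡ true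
        partnerIn-true M′ {y = y} eq with M′ y
        ... | just z = z , refl , eq

        partnerIn-just : ∀ M′ {B y z} → M′ y ≡ just z → B z ≡ true → partnerIn M′ B y ≡ true
        partnerIn-just M′ {y = y} My Bz rewrite My = Bz

        step : (Fin n → Bool) → Fin n → Bool
        step B y = B y ∨ (not (y ∈ᵇ c) ∧ (partnerIn N B y ∨ partnerIn M B y))

        inflationary : ∀ B y → B y ≡ true → step B y ≡ true
        inflationary B y By rewrite By = refl

        extensional : ∀ {A B} → (∀ x → A x ≡ B x) → ∀ y → step A y ≡ step B y
        extensional A≗B y rewrite A≗B y | partnerIn-cong N A≗B y | partnerIn-cong M A≗B y = refl

      open Closure step inflationary extensional using (closure; closure-stable; closure-⊇; closure-ind)

      reachable : Fin n → Bool
      reachable = closure (λ y → does (y ≟ u))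

      OutsideWalk : Fin n → Set
      OutsideWalk x = ∃ λ t → Walk G (x ∷ t) × last (x ∷ t) ≡ just u × (∀ {v} → v ∈ x ∷ t → v ∉ c)

      reachable⇒OutsideWalk : ∀ x → reachable x ≡ true → OutsideWalk x
      reachable⇒OutsideWalk = closure-ind OutsideWalk start extend
        where
        start : ∀ x → does (x ≟ u) ≡ true → OutsideWalk x
        start x x≡u with refl ← from-does (x ≟ u) x≡u = [] , tt , refl , λ { (here refl) → u∉c }
        prepend : ∀ {x z} → E x z → x ∉ c → OutsideWalk z → OutsideWalk x
        prepend xz x∉c (t , w , ends , outside) =
          _ ∷ t , (xz , w) , ends , λ { (here refl) → x∉c ; (there v∈) → outside v∈ }
        extend : ∀ B → (∀ x → B x ≡ true → OutsideWalk x) → ∀ x → step B x ≡ true → OutsideWalk x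
        extend B ih x stepped with B x in Bx
        ... | true  = ih x Bx
        ... | false with x ∈ᵇ c in x∈ᵇc | partnerIn N B x in viaN
        ...   | false | true  with partnerIn-true N viaN
        ...     | z , Nx , Bz = prepend (proj₁ (N-matching x z Nx)) (∈ᵇ-false⇒∉ c x∈ᵇc) (ih z Bz)
        extend B ih x stepped | false | false | false with partnerIn-true M stepped
        ...     | z , Mx , Bz = prepend (proj₁ (M-matching x z Mx)) (∈ᵇ-false⇒∉ c x∈ᵇc) (ih z Bz)

      reachable-u : reachable u ≡ true
      reachable-u = closure-⊇ _ u (dec-true (u ≟ u) refl)

      reachable⇒∉c : ∀ {x} → reachable x ≡ true → x ∉ c
      reachable⇒∉c {x} Kx with reachable⇒OutsideWalk x Kx
      ... | _ , _ , _ , outside = outside (here refl)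

      private
        reach-via : ∀ {y} → y ∉ c → partnerIn N reachable y ∨ partnerIn M reachable y ≡ true → reachable y ≡ true
        reach-via {y} y∉c via =
          trans (sym (closure-stable _ y))
                (trans (cong (reachable y ∨_) (cong₂ _∧_ (cong not (∉⇒∈ᵇ c y∉c)) via)) (∨-zeroʳ (reachable y)))

      reachable-N-closed : Closed N reachable
      reachable-N-closed {x} {y} Nx Kx =
        reach-via y∉c (cong (_∨ partnerIn M reachable y) (partnerIn-just N (proj₂ (N-matching x y Nx)) Kx))
        where
        y∉c : y ∉ c
        y∉c y∈c = contradiction (trans (sym (N-avoids y∈c)) (proj₂ (N-matching x y Nx))) λ ()

      reachable-M-outside : ∀ {x y} → M x ≡ just y → y ∉ c → reachable x ≡ true → reachable y ≡ true
      reachable-M-outside {x} {y} Mx y∉c Kx =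
        reach-via y∉c (trans (cong (partnerIn N reachable y ∨_) (partnerIn-just M (proj₂ (M-matching x y Mx)) Kx))
                             (∨-zeroʳ _))

      reachable-M-into-cycle : ∀ {x y} → M x ≡ just y → y ∈ c → reachable x ≡ true → y ≡ x₀
      reachable-M-into-cycle {x} {y} Mx y∈c Kx with y ≟ x₀
      ... | yes y≡x₀ = y≡x₀
      ... | no  y≢x₀ with reachable⇒OutsideWalk x Kx
      ...   | t , w , ends , outside with shortcut x t w
      ...     | t′ , w′ , unique , ends′ , sub =
        contradiction (proj₁ (isolated (x ∷ t′) y∈c x₀∈c y≢x₀ unique (outside ∘ sub) path)) λ ()
        where
        path : Walk G (y ∷ (x ∷ t′) ++ [ x₀ ])
        path = E-sym (proj₁ (M-matching x y Mx)) ,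
               walk-∷ʳ (x ∷ t′) w′ (trans ends′ ends) (E-sym (proj₁ (M-matching x₀ u M-x₀)))

      reachable⁺ : Fin n → Bool
      reachable⁺ x = reachable x ∨ does (x ≟ x₀)

      reachable⁺-M-closed : Closed M reachable⁺
      reachable⁺-M-closed {x} {y} Mx Kx with reachable x in Kx′ | x ≟ x₀
      ... | false | yes refl with refl ← trans (sym M-x₀) Mx = cong (_∨ _) reachable-u
      ... | true  | _ = by-membership (y ∈? c)
        where
        by-membership : Dec (y ∈ c) → reachable⁺ y ≡ true
        by-membership (yes y∈c) with refl ← reachable-M-into-cycle Mx y∈c Kx′ =
          trans (cong (reachable x₀ ∨_) (dec-true (x₀ ≟ x₀) refl)) (∨-zeroʳ _)
        by-membership (no y∉c) = cong (_∨ _) (reachable-M-outside Mx y∉c Kx′)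

      reachable∪c : Fin n → Bool
      reachable∪c x = reachable x ∨ x ∈ᵇ c

      reachable∪c-N-closed : Closed N reachable∪c
      reachable∪c-N-closed {x} {y} Nx Kx with reachable x in Kx′
      ... | true  = cong (_∨ _) (reachable-N-closed Nx Kx′)
      ... | false = contradiction (trans (sym Nx) (N-avoids (∈ᵇ⇒∈ c Kx))) λ ()

      private
        P = proj₁ (cycle-near-perfect odd-cycle x₀∈c)
        P-matching = proj₁ (proj₂ (cycle-near-perfect odd-cycle x₀∈c))
        P-saturated = proj₂ (proj₂ (cycle-near-perfect odd-cycle x₀∈c))

      swapped : Mate G
      swapped = (N ↾ reachable) ∪ (M ↾ (not ∘ reachable⁺))

      -- rival only serves to be counted: ∥ swapped ∥ + ∥ rival ∥ = ∥ M ∥ + ∥ N ∥ + |c| - 1 and ∥ rival ∥ ≤ S.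
      rival : Mate G
      rival = ((M ↾ reachable⁺) ∪ P) ∪ (N ↾ (not ∘ reachable∪c))

      private
        sat-↾ : ∀ M′ A x → saturated (M′ ↾ A) x ≡ true → A x ≡ true
        sat-↾ M′ A = ↾-support {M = M′} {A = A}

        false≢true : ∀ {b} → b ≡ false → b ≡ true → ⊥
        false≢true refl ()

        ∨-true : ∀ {a b} → a ∨ b ≡ true → a ≡ true ⊎ b ≡ true
        ∨-true {true}  _  = inj₁ refl
        ∨-true {false} eq = inj₂ eq

        unreachable-on-c : ∀ {x} → x ∈ c → reachable x ≡ false
        unreachable-on-c {x} x∈c with reachable x in Kx
        ... | false = refl
        ... | true  = contradiction x∈c (reachable⇒∉c Kx)

        reachable⁺⇒reachable∪c : ∀ x → reachable⁺ x ≡ true → reachable∪c x ≡ true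
        reachable⁺⇒reachable∪c x K⁺x with ∨-true K⁺x
        ... | inj₁ Kx   = cong (_∨ _) Kx
        ... | inj₂ x≡x₀ with refl ← from-does (x ≟ x₀) x≡x₀ =
          trans (cong (reachable x₀ ∨_) (∈⇒∈ᵇ c x₀∈c)) (∨-zeroʳ (reachable x₀))

        disjoint₁ : Disjoint (N ↾ reachable) (M ↾ (not ∘ reachable⁺))
        disjoint₁ x sat₁ sat₂ =
          false≢true (∨-conicalˡ (reachable x) _ (not-injective (sat-↾ M (not ∘ reachable⁺) x sat₂)))
                     (sat-↾ N reachable x sat₁)

        disjoint₂ : Disjoint (M ↾ reachable⁺) P
        disjoint₂ x sat₁ sat₂ = false≢true unreachable⁺ (sat-↾ M reachable⁺ x sat₁)
          where
          on-cycle : x ∈ᵇ c ∧ not (does (x ≟ x₀)) ≡ true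
          on-cycle = trans (sym (P-saturated x)) sat₂
          unreachable⁺ : reachable⁺ x ≡ false
          unreachable⁺ = cong₂ _∨_ (unreachable-on-c (∈ᵇ⇒∈ c (∧-conicalˡ (x ∈ᵇ c) _ on-cycle)))
                                   (not-injective (∧-conicalʳ (x ∈ᵇ c) _ on-cycle))

        disjoint₃ : Disjoint ((M ↾ reachable⁺) ∪ P) (N ↾ (not ∘ reachable∪c))
        disjoint₃ x sat₁ sat₂ = false≢true (not-injective (sat-↾ N (not ∘ reachable∪c) x sat₂)) covered
          where
          covered : reachable∪c x ≡ true
          covered with ∨-true (trans (sym (∪-saturated {M = M ↾ reachable⁺} {N = P} x)) sat₁)
          ... | inj₁ sat-M = reachable⁺⇒reachable∪c x (sat-↾ M reachable⁺ x sat-M)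
          ... | inj₂ sat-P = trans (cong (reachable x ∨_) (∧-conicalˡ (x ∈ᵇ c) _ (trans (sym (P-saturated x)) sat-P)))
                                   (∨-zeroʳ (reachable x))

      swapped-matching : IsMatching G swapped
      swapped-matching = ∪-matching (↾-matching N-matching) (↾-matching M-matching) disjoint₁

      rival-matching : IsMatching G rival
      rival-matching =
        ∪-matching (∪-matching (↾-matching M-matching) P-matching disjoint₂) (↾-matching N-matching) disjoint₃

      private
        N-in M-out M-in N-out : ℕ
        N-in  = count (λ x → reachable x ∧ saturated N x)
        M-out = count (λ x → not (reachable⁺ x) ∧ saturated M x)
        M-in  = count (λ x → reachable⁺ x ∧ saturated M x)
        N-out = count (λ x → not (reachable∪c x) ∧ saturated N x)

        ∥swapped∥ : ∥ swapped ∥ ≡ N-in + M-out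
        ∥swapped∥ = trans (∥∪∥ disjoint₁)
          (cong₂ _+_ (∥↾∥ reachable-N-closed) (∥↾∥ (Closed-complement M-matching reachable⁺-M-closed)))

        ∥rival∥ : ∥ rival ∥ ≡ M-in + ∥ P ∥ + N-out
        ∥rival∥ = trans (∥∪∥ disjoint₃)
          (cong₂ _+_ (trans (∥∪∥ disjoint₂) (cong (_+ ∥ P ∥) (∥↾∥ reachable⁺-M-closed)))
                     (∥↾∥ (Closed-complement N-matching reachable∪c-N-closed)))

        ∥M∥ : ∥ M ∥ ≡ M-in + M-out
        ∥M∥ = count-partition reachable⁺ (saturated M)

        ∥N∥ : ∥ N ∥ ≡ N-in + N-out
        ∥N∥ = trans (count-partition reachable (saturated N)) (cong (N-in +_) (count-cong off-cycle))
          where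
          off-cycle : ∀ x → not (reachable x) ∧ saturated N x ≡ not (reachable∪c x) ∧ saturated N x
          off-cycle x with x ∈ᵇ c in x∈ᵇc
          ... | false = cong (λ k → not k ∧ saturated N x) (sym (∨-identityʳ (reachable x)))
          ... | true  rewrite N-avoids (∈ᵇ⇒∈ c x∈ᵇc) = trans (∧-zeroʳ _) (sym (∧-zeroʳ _))

        ∥P∥+1 : ∥ P ∥ + 1 ≡ length c
        ∥P∥+1 = trans (cong (_+ 1) (count-cong P-saturated))
                      (trans (count-without (_∈ᵇ c) (∈⇒∈ᵇ c x₀∈c)) (count-∈ᵇ unique-c))

      S≤∥swapped∥ : S ≤ ∥ swapped ∥
      S≤∥swapped∥ = subst (S ≤_) (sym ∥swapped∥)
        (exchange-arith S N-in M-out M-in N-out ∥ P ∥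
          (subst (_≤ S) ∥rival∥ (S-max rival-matching))
          (subst (S ≤_) ∥M∥ M-large)
          (subst₂ (λ k l → S + 1 ≤ k + l) ∥N∥ (sym ∥P∥+1) N-large))

      private
        swapped-on-c : ∀ {x} → x ∈ c → swapped x ≡ (M ↾ (not ∘ reachable⁺)) x
        swapped-on-c x∈c = ∪-right {M = N ↾ reachable} {N = M ↾ (not ∘ reachable⁺)}
                                   (↾-outside {M = N} {A = reachable} (unreachable-on-c x∈c))

        swapped-on-cycle : ∀ {x} → x ∈ c → x ≢ x₀ → swapped x ≡ M x
        swapped-on-cycle {x} x∈c x≢x₀ =
          trans (swapped-on-c x∈c)
                (↾-agrees (Closed-complement M-matching reachable⁺-M-closed) (cong not unreachable⁺))
          where
          unreachable⁺ : reachable⁺ x ≡ false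
          unreachable⁺ = cong₂ _∨_ (unreachable-on-c x∈c) (dec-false (x ≟ x₀) x≢x₀)

        swapped-x₀ : swapped x₀ ≡ nothing
        swapped-x₀ =
          trans (swapped-on-c x₀∈c)
                (↾-outside {M = M} {A = not ∘ reachable⁺}
                   (cong not (trans (cong (reachable x₀ ∨_) (dec-true (x₀ ≟ x₀) refl)) (∨-zeroʳ _))))

      countM-swapped : countM G swapped c ≡ countM G M c
      countM-swapped = countᴸ-cong (cycEdges G c) λ (x , y) edge → same-edge (cycEdges-∈ˡ edge) (cycEdges-∈ʳ edge)
        where
        at-x₀ : ∀ {y} → y ∈ c → inM G swapped x₀ y ≡ inM G M x₀ y
        at-x₀ {y} y∈c = trans (inM-nothing swapped swapped-x₀ y)
                              (sym (trans (inM-just M M-x₀ y) (dec-false (u ≟ y) λ { refl → u∉c y∈c })))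
        same-edge : ∀ {x y} → x ∈ c → y ∈ c → inM G swapped x y ≡ inM G M x y
        same-edge {x} {y} x∈c y∈c = by-vertex (x ≟ x₀)
          where
          by-vertex : Dec (x ≡ x₀) → inM G swapped x y ≡ inM G M x y
          by-vertex (yes refl) = at-x₀ y∈c
          by-vertex (no x≢x₀)  = inM-cong {M = swapped} {M′ = M} (swapped-on-cycle x∈c x≢x₀) y

      crossing-swapped : count (crossing swapped) < count (crossing M)
      crossing-swapped = count-mono-< fewer x₀ (cong (leaves x₀) swapped-x₀) crossing-x₀
        where
        crossing-x₀ : crossing M x₀ ≡ true
        crossing-x₀ rewrite M-x₀ | ∈⇒∈ᵇ c x₀∈c | ∉⇒∈ᵇ c u∉c = refl
        fewer : ∀ x → crossing swapped x ≡ true → crossing M x ≡ true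
        fewer x crosses = by-vertex (x ≟ x₀) (x ∈? c)
          where
          by-vertex : Dec (x ≡ x₀) → Dec (x ∈ c) → crossing M x ≡ true
          by-vertex (yes refl) _         = contradiction (trans (sym (cong (leaves x₀) swapped-x₀)) crosses) λ ()
          by-vertex (no x≢x₀)  (yes x∈c) = trans (cong (leaves x) (sym (swapped-on-cycle x∈c x≢x₀))) crosses
          by-vertex (no x≢x₀)  (no x∉c)  =
            contradiction (trans (sym (∉⇒∈ᵇ c x∉c)) (leaves-on-cycle (swapped x) crosses)) λ ()
            where
            leaves-on-cycle : ∀ m → leaves x m ≡ true → x ∈ᵇ c ≡ true
            leaves-on-cycle (just y) eq = ∧-conicalˡ (x ∈ᵇ c) _ eq

  private
    crossing-witness : ∀ M {x} → crossing M x ≡ true → x ∈ c × ∃ λ u → M x ≡ just u × u ∉ c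
    crossing-witness M {x} crosses with M x
    ... | just u = ∈ᵇ⇒∈ c (∧-conicalˡ _ _ crosses) , u , refl ,
                   ∈ᵇ-false⇒∉ c (not-injective (∧-conicalʳ (x ∈ᵇ c) _ crosses))

  half≤countM : ∀ {M} → IsMatching G M → S ≤ ∥ M ∥ → ⌊ length c /2⌋ ≤ countM G M c
  half≤countM {M} M-matching M-large = <-rec P induction (count (crossing M)) refl M-matching M-large
    where
    P : ℕ → Set
    P k = ∀ {M} → count (crossing M) ≡ k → IsMatching G M → S ≤ ∥ M ∥ → ⌊ length c /2⌋ ≤ countM G M c
    induction : ∀ k → (∀ {j} → j < k → P j) → P k
    induction zero    _  uncrossed M-matching M-large = Uncrossed.half≤countM M-matching M-large uncrossed
    induction (suc k) ih {M} crossings M-matching M-large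
      with count>0 (crossing M) (subst (0 <_) (sym crossings) (s≤s z≤n))
    ... | x₀ , crosses with crossing-witness M crosses
    ...   | x₀∈c , u , M-x₀ , u∉c =
      subst (⌊ length c /2⌋ ≤_) countM-swapped
        (ih (subst (count (crossing swapped) <_) crossings crossing-swapped) refl swapped-matching S≤∥swapped∥)
      where open Uncross M-matching M-large x₀∈c M-x₀ u∉c

open Parity using (⌊2*n/2⌋≡n)

mainTheorem4 : (G : Graph) → RDisjoint G →
    ∀ M → IsMaximum G M → ∀ c → IsOddCycle G c →
    countM G M c ≡ ⌊ length c /2⌋
mainTheorem4 G rd M M-max@(M-matching , _) c oc@((3≤c , unique-c , _) , _) =
  ≤-antisym countM≤half half≤countM
  where
  open Matchings G using (∥_∥; maximum-∥∥)
  countM≤half : countM G M c ≤ ⌊ length c /2⌋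
  countM≤half = subst (_≤ ⌊ length c /2⌋) (⌊2*n/2⌋≡n (countM G M c))
    (⌊n/2⌋-mono (CycleMatching.2*countM≤length G M-matching unique-c 3≤c))
  half≤countM : ⌊ length c /2⌋ ≤ countM G M c
  half≤countM with Flowers.RDisjoint⇒avoiding-matching G rd M-max oc
  ... | N , N-matching , N-avoids , N-large =
    Exchange.half≤countM G oc (Isolation.RDisjoint⇒Isolated G rd oc) N-matching N-avoids ∥ M ∥
      (maximum-∥∥ M-max) N-large M-matching ≤-refl
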